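{- Let $\mathbb{F}$ be a field of characteristic $p$ and let $q = p^k$. Suppose $T: \mathbb{F}[y] \to \mathbb{F}[y]$ is an $\mathbb{F}$-linear operator such that: (1) there is an integer $E \geq 1$ with $\deg T(f) \leq \deg f - E$ for all $f \in \mathbb{F}[y]$; (2) the sequence $\{T(y^n)\}_n$ satisfies a linear recursion whose companion polynomial has the form $$P = (X + c y)^d + (\text{terms of total degree} \leq d - D) \in \mathbb{F}[y][X]$$ for some $d \leq q$, some $D \geq 1$ with $q - D \geq 2$, and some $c \in \mathbb{F}$. Then for all $f \in \mathbb{F}[y]$, $$N_T(f) \leq \frac{(q-D)(q-1)}{E(q-D-1)} (\deg f)^{\log(q-D)/\log q}.$$
   Context: A sequence $\{s_n\}$ in $\mathbb{F}[y]$ satisfies the linear recursion with companion polynomial $X^d - a_1X^{d-1} - \cdots - a_d \in \mathbb{F}[y][X]$ if $s_n = a_1 s_{n-1} + \cdots + a_d s_{n-d}$ for all $n \geq d$. Total degree is in $y, X$. $\deg 0 = -\infty$. For $f \neq 0$, $N_T(f) := \max\{k \geq 0 : T^k f \neq 0\}$, and $N_T(0) = -\infty$. -}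

module Defs where

open import Level using (Level; _⊔_)
open import Algebra.Bundles using (CommutativeRing)
open import Data.Nat as ℕ using (ℕ; zero; suc; _∸_; _^_)
open import Data.Integer as ℤ using (ℤ; +_)
open import Data.List using (List; []; _∷_; map; reverse; _++_; foldr)
open import Data.Vec as Vec using (Vec)
open import Data.Fin using (Fin; toℕ)
open import Data.Product using (Σ; _×_; ∃)
open import Relation.Nullary using (¬_)
open import Relation.Binary.PropositionalEquality using (_≡_)
open import Data.Nat.Primality using (Prime)

record Field (c ℓ : Level) : Set (Level.suc (c ⊔ ℓ)) where
  field
    commRing : CommutativeRing c ℓ
  open CommutativeRing commRing public
  field
    0≉1     : ¬ (0# ≈ 1#)
    inverse : ∀ x → ¬ (x ≈ 0#) → Σ Carrier (λ y → x * y ≈ 1#)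

-- Generic dense univariate polynomials (coefficient lists, constant
-- term first) over a carrier with 0, +, -, *.

module ListPoly {a} (A : Set a) (zeroA : A) (_+A_ _*A_ : A → A → A) (negA : A → A) where

  Pol : Set a
  Pol = List A

  coeff : Pol → ℕ → A
  coeff []      _       = zeroA
  coeff (x ∷ f) zero    = x
  coeff (x ∷ f) (suc i) = coeff f i

  _⊕_ : Pol → Pol → Pol
  []      ⊕ g       = g
  (x ∷ f) ⊕ []      = x ∷ f
  (x ∷ f) ⊕ (y ∷ g) = (x +A y) ∷ (f ⊕ g)

  neg : Pol → Pol
  neg = map negA

  scale : A → Pol → Pol
  scale c = map (c *A_)

  _⊛_ : Pol → Pol → Pol
  []      ⊛ g = []
  (x ∷ f) ⊛ g = scale x g ⊕ (zeroA ∷ (f ⊛ g))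

  sumPol : List Pol → Pol
  sumPol = foldr _⊕_ []

module Polys {c ℓ} (F : Field c ℓ) where
  open Field F public

  open ListPoly Carrier 0# _+_ _*_ -_ public

  Poly : Set c
  Poly = Pol

  _≈ₚ_ : Poly → Poly → Set ℓ
  f ≈ₚ g = ∀ i → coeff f i ≈ coeff g i

  zeroP : Poly
  zeroP = []

  oneP : Poly
  oneP = 1# ∷ []

  yPow : ℕ → Poly
  yPow zero    = 1# ∷ []
  yPow (suc n) = 0# ∷ yPow n

  -- deg f ≤ k   (k : ℤ; for k < 0 this says f = 0, i.e. deg f = -∞)
  DegAtMost : Poly → ℤ → Set ℓ
  DegAtMost f k = ∀ (i : ℕ) → k ℤ.< + i → coeff f i ≈ 0#

  IsDeg : Poly → ℕ → Set ℓ
  IsDeg f n = ¬ (coeff f n ≈ 0#) × DegAtMost f (+ n)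

  record IsLinear (T : Poly → Poly) : Set (c ⊔ ℓ) where
    field
      cong  : ∀ f g → f ≈ₚ g → T f ≈ₚ T g
      additive : ∀ f g → T (f ⊕ g) ≈ₚ (T f ⊕ T g)
      homogeneous : ∀ (a : Carrier) f → T (scale a f) ≈ₚ scale a (T f)

  iter : (Poly → Poly) → ℕ → Poly → Poly
  iter T zero    f = f
  iter T (suc k) f = T (iter T k f)

  -- N_T(f) = k  for f ≠ 0: k is the largest k with T^k f ≠ 0
  IsN : (Poly → Poly) → Poly → ℕ → Set ℓ
  IsN T f k = ¬ (iter T k f ≈ₚ zeroP) × (iter T (suc k) f ≈ₚ zeroP)

  -- F[y][X]: lists of elements of F[y], constant (in X) term first
  module PX = ListPoly Poly zeroP _⊕_ _⊛_ neg
  PolyX : Set c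
  PolyX = PX.Pol

  -- total degree in (y, X) is ≤ m  (m : ℤ; m < 0 means the polynomial is 0)
  TotDegAtMost : PolyX → ℤ → Set ℓ
  TotDegAtMost P m = ∀ (j i : ℕ) → m ℤ.< + (i ℕ.+ j) → coeff (PX.coeff P j) i ≈ 0#

  powX : PolyX → ℕ → PolyX
  powX P zero    = oneP ∷ []
  powX P (suc n) = P PX.⊛ powX P n

  -- X + c y  ∈ F[y][X]
  XplusCy : Carrier → PolyX
  XplusCy a = (0# ∷ a ∷ []) ∷ oneP ∷ []

  -- companion polynomial X^d - a_1 X^{d-1} - ... - a_d, where
  -- (Vec.lookup as i) is a_{i+1}
  companion : ∀ {d} → Vec Poly d → PolyX
  companion as = map neg (reverse (Vec.toList as)) ++ (oneP ∷ [])

  SatisfiesRecursion : ∀ {d} → (ℕ → Poly) → Vec Poly d → Set ℓ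
  SatisfiesRecursion {d} s as =
    ∀ n → d ℕ.≤ n →
      s n ≈ₚ sumPol (Vec.toList (Vec.tabulate (λ (i : Fin d) →
                        Vec.lookup as i ⊛ s (n ∸ suc (toℕ i)))))

  natToF : ℕ → Carrier
  natToF zero    = 0#
  natToF (suc n) = 1# + natToF n

-- The real-valued bound, encoded in natural-number arithmetic.
--
-- With r = q - D (so 2 ≤ r < q), C = r(q-1)/(E(r-1)) and α = log r / log q,
-- "N ≤ C · n^α" for natural N, n is equivalent to:
--   * if n = 0 then N = 0        (0^α = 0 as α > 0), and
--   * for all a, b ∈ ℕ with b ≥ 1: if (N/C)^b > r^a then n^b ≥ q^a,
-- i.e. every rational a/b < log_r(N/C) satisfies a/b ≤ log_q n, which says
-- log_r (N/C) ≤ log_q n, i.e. N/C ≤ r^{log_q n} = n^α.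
-- Clearing denominators, (N/C)^b > r^a  ⇔  r^(a+b) (q-1)^b < (N E (r-1))^b.

PowerBound : (q D E N n : ℕ) → Set
PowerBound q D E N n =
  (n ≡ 0 → N ≡ 0) ×
  (∀ (a b : ℕ) → 1 ℕ.≤ b →
     ((q ∸ D) ^ (a ℕ.+ b)) ℕ.* ((q ∸ 1) ^ b) ℕ.< (N ℕ.* E ℕ.* ((q ∸ D) ∸ 1)) ^ b →
     q ^ a ℕ.≤ n ^ b)

{-# OPTIONS --safe #-}
-- Put r = q − D and weigh n = Σ nᵢ qⁱ (base-q digits) by w n = Σ nᵢ rⁱ. The heart of the proof is that T
-- lowers this weight by E: every yᵐ occurring in T yⁿ has w m + E ≤ w n. For n < q this is the degree
-- hypothesis. Otherwise the companion polynomial P annihilates every sequence j ↦ T (yʲ h), hence so does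
-- Q = (X + cy)^(q−d) P = X^q + (cy)^q + R, where R has total degree ≤ q − D. In characteristic p,
-- Q^(qᵉ) = X^(q^(e+1)) + (cy)^(q^(e+1)) + R^(qᵉ), which expresses T (y^(q^(e+1)) h) through the terms
-- y^(i qᵉ) T (y^(j qᵉ) h) with i + j ≤ r. As w is subadditive, w (b qᵉ) = rᵉ w b and
-- w (q^(e+1) + n′) ≥ r^(e+1) + w n′, induction on n bounds all these weights. By linearity T then lowers
-- the weight of every polynomial, so N E is at most the largest weight of an exponent ≤ deg f, which is
-- below (q − 1) r^(L+1) / (r − 1) when q^L ≤ deg f; this is the claimed bound.
module Submission where

open import Defs
open import Algebra.Bundles using (CommutativeRing)
open import Data.Nat as ℕ using (ℕ)
open import Data.Nat.Primality using (Prime)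
import Data.Integer as ℤ
open import Data.Vec using (Vec)
import Data.Nat.Properties as ℕₚ
import Data.Integer.Properties as ℤₚ
open import Relation.Binary.PropositionalEquality as ≡ using (_≡_)

module DigitWeight (q r : ℕ) (1<q : 1 ℕ.< q) (r≤q : r ℕ.≤ q) where

  open import Data.Nat
  open import Data.Nat.Properties
  open import Data.Nat.DivMod
  open import Data.Nat.Divisibility using (divides-refl)
  open import Data.Nat.Induction using (<-rec)
  open import Data.Product using (Σ-syntax; _×_; _,_)
  open import Relation.Binary.PropositionalEquality
  open import Relation.Nullary using (yes; no)
  open import Data.Nat.Tactic.RingSolver using (solve-∀)

  instance
    q≢0 : NonZero q
    q≢0 = >-nonZero (<-trans z<s 1<q)

  private
    weightWithFuel : ℕ → ℕ → ℕ
    weightWithFuel zero    n = 0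
    weightWithFuel (suc k) n = n % q + r * weightWithFuel k (n / q)

  -- w (Σ nᵢ qⁱ) = Σ nᵢ rⁱ over the base-q digits nᵢ of n; fuel n suffices as n / q < n.
  w : ℕ → ℕ
  w n = weightWithFuel n n

  private
    n/q<n : ∀ n → .{{NonZero n}} → n / q < n
    n/q<n n = m/n<m n q 1<q

    0%q+r*0/q : ∀ (f : ℕ → ℕ) → 0 % q + r * f (0 / q) ≡ r * f 0
    0%q+r*0/q f = cong₂ (λ a b → a + r * f b) (m<n⇒m%n≡m (<-trans z<s 1<q)) (0/n≡0 q)

    weightWithFuel-0 : ∀ k → weightWithFuel k 0 ≡ 0
    weightWithFuel-0 zero    = refl
    weightWithFuel-0 (suc k) = begin
      0 % q + r * weightWithFuel k (0 / q)  ≡⟨ 0%q+r*0/q (weightWithFuel k) ⟩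
      r * weightWithFuel k 0                ≡⟨ cong (r *_) (weightWithFuel-0 k) ⟩
      r * 0                                 ≡⟨ *-zeroʳ r ⟩
      0                                     ∎
      where open ≡-Reasoning

    weightWithFuel-irrelevant : ∀ k k′ n → n ≤ k → n ≤ k′ → weightWithFuel k n ≡ weightWithFuel k′ n
    weightWithFuel-irrelevant k k′ zero _ _ = trans (weightWithFuel-0 k) (sym (weightWithFuel-0 k′))
    weightWithFuel-irrelevant (suc k) (suc k′) n@(suc _) n≤k n≤k′ =
      cong (λ x → n % q + r * x) (weightWithFuel-irrelevant k k′ (n / q)
        (≤-trans (s≤s⁻¹ (n/q<n n)) (s≤s⁻¹ n≤k)) (≤-trans (s≤s⁻¹ (n/q<n n)) (s≤s⁻¹ n≤k′)))

  w-unfold : ∀ n → w n ≡ n % q + r * w (n / q)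
  w-unfold zero      = sym (trans (0%q+r*0/q w) (*-zeroʳ r))
  w-unfold n@(suc m) = cong (λ x → n % q + r * x)
    (weightWithFuel-irrelevant m (n / q) (n / q) (s≤s⁻¹ (n/q<n n)) ≤-refl)

  w-digit : ∀ a b → a < q → w (a + b * q) ≡ a + r * w b
  w-digit a b a<q = begin
    w (a + b * q)                               ≡⟨ w-unfold (a + b * q) ⟩
    (a + b * q) % q + r * w ((a + b * q) / q)   ≡⟨ cong₂ (λ x y → x + r * w y) remainder quotient ⟩
    a + r * w b                                 ∎
    where
    open ≡-Reasoning
    remainder : (a + b * q) % q ≡ a
    remainder = trans ([m+kn]%n≡m%n a b q) (m<n⇒m%n≡m a<q)
    quotient : (a + b * q) / q ≡ b
    quotient = trans (+-distrib-/-∣ʳ a (divides-refl b)) (cong₂ _+_ (m<n⇒m/n≡0 a<q) (m*n/n≡m b q))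

  w-small : ∀ a → a < q → w a ≡ a
  w-small a a<q = begin
    w a             ≡⟨ cong w (sym (+-identityʳ a)) ⟩
    w (a + 0 * q)   ≡⟨ w-digit a 0 a<q ⟩
    a + r * 0       ≡⟨ cong (a +_) (*-zeroʳ r) ⟩
    a + 0           ≡⟨ +-identityʳ a ⟩
    a               ∎
    where open ≡-Reasoning

  w-*q : ∀ b → w (b * q) ≡ r * w b
  w-*q b = w-digit 0 b (<-trans z<s 1<q)

  w-suc : ∀ n → w (suc n) ≤ suc (w n)
  w-suc = <-rec _ step
    where
    open ≤-Reasoning
    step : ∀ n → (∀ {m} → m < n → w (suc m) ≤ suc (w m)) → w (suc n) ≤ suc (w n)
    step n rec with suc (n % q) <? q
    ... | yes 1+n%q<q = ≤-reflexive (begin-equality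
      w (suc n)                          ≡⟨ cong (λ m → w (suc m)) (m≡m%n+[m/n]*n n q) ⟩
      w (suc (n % q) + n / q * q)        ≡⟨ w-digit (suc (n % q)) (n / q) 1+n%q<q ⟩
      suc (n % q + r * w (n / q))        ≡⟨ cong suc (w-unfold n) ⟨
      suc (w n)                          ∎)
    ... | no 1+n%q≮q = begin
      w (suc n)                          ≡⟨ cong w carry ⟩
      w (suc (n / q) * q)                ≡⟨ w-*q (suc (n / q)) ⟩
      r * w (suc (n / q))                ≤⟨ *-monoʳ-≤ r (rec (n/q<n n)) ⟩
      r * suc (w (n / q))                ≡⟨ *-suc r (w (n / q)) ⟩
      r + r * w (n / q)                  ≤⟨ +-monoˡ-≤ (r * w (n / q)) r≤q ⟩
      q + r * w (n / q)                  ≡⟨ cong (λ x → x + r * w (n / q)) last-digit ⟨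
      suc (n % q + r * w (n / q))        ≡⟨ cong suc (w-unfold n) ⟨
      suc (w n)                          ∎
      where
      last-digit : suc (n % q) ≡ q
      last-digit = ≤-antisym (m%n<n n q) (≮⇒≥ 1+n%q≮q)
      instance
        n≢0 : NonZero n
        n≢0 = >-nonZero (<-≤-trans (s≤s⁻¹ (subst (1 <_) (sym last-digit) 1<q)) (m%n≤m n q))
      carry : suc n ≡ suc (n / q) * q
      carry = begin-equality
        suc n                     ≡⟨ cong suc (m≡m%n+[m/n]*n n q) ⟩
        suc (n % q) + n / q * q   ≡⟨ cong (_+ n / q * q) last-digit ⟩
        q + n / q * q             ∎

  w-+ˡ : ∀ t m → w (t + m) ≤ t + w m
  w-+ˡ zero    m = ≤-refl
  w-+ˡ (suc t) m = ≤-trans (w-suc (t + m)) (s≤s (w-+ˡ t m))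

  w-≤ : ∀ m → w m ≤ m
  w-≤ m = subst (λ x → w x ≤ x) (+-identityʳ m) (w-+ˡ m 0)

  w-digit-≤ : ∀ x m → w (x + m * q) ≤ x + r * w m
  w-digit-≤ x m = begin
    w (x + m * q)                               ≡⟨ cong w split ⟩
    w (x % q + (x / q + m) * q)                 ≡⟨ w-digit (x % q) (x / q + m) (m%n<n x q) ⟩
    x % q + r * w (x / q + m)                   ≤⟨ +-monoʳ-≤ (x % q) (*-monoʳ-≤ r (w-+ˡ (x / q) m)) ⟩
    x % q + r * (x / q + w m)                   ≡⟨ regroup (x % q) r (x / q) (w m) ⟩
    (x % q + r * (x / q)) + r * w m             ≤⟨ +-monoˡ-≤ (r * w m) (+-monoʳ-≤ (x % q) r*[x/q]≤) ⟩
    (x % q + x / q * q) + r * w m               ≡⟨ cong (_+ r * w m) (m≡m%n+[m/n]*n x q) ⟨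
    x + r * w m                                 ∎
    where
    open ≤-Reasoning
    split : x + m * q ≡ x % q + (x / q + m) * q
    split = trans (cong (_+ m * q) (m≡m%n+[m/n]*n x q)) (shuffle (x % q) (x / q) m q)
      where
      shuffle : ∀ a b c d → (a + b * d) + c * d ≡ a + (b + c) * d
      shuffle = solve-∀
    regroup : ∀ a b c d → a + b * (c + d) ≡ (a + b * c) + b * d
    regroup = solve-∀
    r*[x/q]≤ : r * (x / q) ≤ x / q * q
    r*[x/q]≤ = ≤-trans (*-monoˡ-≤ (x / q) r≤q) (≤-reflexive (*-comm q (x / q)))

  w-subadditive : ∀ a b → w (a + b) ≤ w a + w b
  w-subadditive = <-rec _ step
    where
    open ≤-Reasoning
    step : ∀ a → (∀ {a′} → a′ < a → ∀ b → w (a′ + b) ≤ w a′ + w b) → ∀ b → w (a + b) ≤ w a + w b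
    step zero     _   b = ≤-refl
    step a@(suc _) rec b = begin
      w (a + b)
        ≡⟨ cong w split ⟩
      w ((a % q + b % q) + (a / q + b / q) * q)
        ≤⟨ w-digit-≤ (a % q + b % q) (a / q + b / q) ⟩
      (a % q + b % q) + r * w (a / q + b / q)
        ≤⟨ +-monoʳ-≤ (a % q + b % q) (*-monoʳ-≤ r (rec (n/q<n a) (b / q))) ⟩
      (a % q + b % q) + r * (w (a / q) + w (b / q))
        ≡⟨ regroup (a % q) (b % q) r (w (a / q)) (w (b / q)) ⟩
      (a % q + r * w (a / q)) + (b % q + r * w (b / q))
        ≡⟨ cong₂ _+_ (w-unfold a) (w-unfold b) ⟨
      w a + w b ∎
      where
      split : a + b ≡ (a % q + b % q) + (a / q + b / q) * q
      split = trans (cong₂ _+_ (m≡m%n+[m/n]*n a q) (m≡m%n+[m/n]*n b q)) (shuffle (a % q) (b % q) (a / q) (b / q) q)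
        where
        shuffle : ∀ x y z u v → (x + z * v) + (y + u * v) ≡ (x + y) + (z + u) * v
        shuffle = solve-∀
      regroup : ∀ x y z u v → (x + y) + z * (u + v) ≡ (x + z * u) + (y + z * v)
      regroup = solve-∀

  w-*q^ : ∀ i b → w (b * q ^ i) ≡ r ^ i * w b
  w-*q^ zero    b = trans (cong w (*-identityʳ b)) (sym (+-identityʳ (w b)))
  w-*q^ (suc i) b = begin
    w (b * (q * q ^ i))     ≡⟨ cong w (reassoc b q (q ^ i)) ⟩
    w ((b * q ^ i) * q)     ≡⟨ w-*q (b * q ^ i) ⟩
    r * w (b * q ^ i)       ≡⟨ cong (r *_) (w-*q^ i b) ⟩
    r * (r ^ i * w b)       ≡⟨ *-assoc r (r ^ i) (w b) ⟨
    r * r ^ i * w b         ∎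
    where
    open ≡-Reasoning
    reassoc : ∀ x y z → x * (y * z) ≡ (x * z) * y
    reassoc = solve-∀

  w-q^ : ∀ i → w (q ^ i) ≡ r ^ i
  w-q^ i = begin
    w (q ^ i)           ≡⟨ cong w (*-identityˡ (q ^ i)) ⟨
    w (1 * q ^ i)       ≡⟨ w-*q^ i 1 ⟩
    r ^ i * w 1         ≡⟨ cong (r ^ i *_) (w-small 1 1<q) ⟩
    r ^ i * 1           ≡⟨ *-identityʳ (r ^ i) ⟩
    r ^ i               ∎
    where open ≡-Reasoning

  w-+q^ : ∀ i m → m + q ^ i < q ^ suc i → w m + r ^ i ≤ w (m + q ^ i)
  w-+q^ zero m m+1<q = ≤-reflexive (begin-equality
    w m + 1         ≡⟨ cong (_+ 1) (w-small m (<-trans (m<m+n m z<s) m+1<q′)) ⟩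
    m + 1           ≡⟨ w-small (m + 1) m+1<q′ ⟨
    w (m + 1)       ∎)
    where
    open ≤-Reasoning
    m+1<q′ : m + 1 < q
    m+1<q′ = subst (m + 1 <_) (*-identityʳ q) m+1<q
  w-+q^ (suc i) m bound = begin
    w m + r * r ^ i                           ≡⟨ cong (_+ r * r ^ i) (w-unfold m) ⟩
    (m % q + r * w (m / q)) + r * r ^ i       ≡⟨ regroup (m % q) r (w (m / q)) (r ^ i) ⟩
    m % q + r * (w (m / q) + r ^ i)           ≤⟨ +-monoʳ-≤ (m % q) (*-monoʳ-≤ r (w-+q^ i (m / q) bound′)) ⟩
    m % q + r * w (m / q + q ^ i)             ≡⟨ w-digit (m % q) (m / q + q ^ i) (m%n<n m q) ⟨
    w (m % q + (m / q + q ^ i) * q)           ≡⟨ cong w split ⟨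
    w (m + q * q ^ i)                         ∎
    where
    open ≤-Reasoning
    regroup : ∀ a b c d → (a + b * c) + b * d ≡ a + b * (c + d)
    regroup = solve-∀
    split : m + q * q ^ i ≡ m % q + (m / q + q ^ i) * q
    split = trans (cong (_+ q * q ^ i) (m≡m%n+[m/n]*n m q)) (shuffle (m % q) (m / q) q (q ^ i))
      where
      shuffle : ∀ a b c d → (a + b * c) + c * d ≡ a + (b + d) * c
      shuffle = solve-∀
    bound′ : m / q + q ^ i < q ^ suc i
    bound′ = *-cancelʳ-< q _ _ (begin-strict
      (m / q + q ^ i) * q                  ≤⟨ m≤n+m _ (m % q) ⟩
      m % q + (m / q + q ^ i) * q          ≡⟨ split ⟨
      m + q ^ suc i                        <⟨ bound ⟩
      q ^ suc (suc i)                      ≡⟨ *-comm q (q ^ suc i) ⟩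
      q ^ suc i * q                        ∎)

  w-tail-bound : ∀ e i j n′ → i + j ≤ r → w (j * q ^ e + n′) + w (i * q ^ e) ≤ r ^ suc e + w n′
  w-tail-bound e i j n′ i+j≤r = begin
    w (j * q ^ e + n′) + w (i * q ^ e)
      ≤⟨ +-monoˡ-≤ (w (i * q ^ e)) (w-subadditive (j * q ^ e) n′) ⟩
    (w (j * q ^ e) + w n′) + w (i * q ^ e)
      ≡⟨ cong₂ (λ x y → (x + w n′) + y) (w-*q^ e j) (w-*q^ e i) ⟩
    (r ^ e * w j + w n′) + r ^ e * w i
      ≤⟨ +-mono-≤ (+-monoˡ-≤ (w n′) (*-monoʳ-≤ (r ^ e) (w-≤ j))) (*-monoʳ-≤ (r ^ e) (w-≤ i)) ⟩
    (r ^ e * j + w n′) + r ^ e * i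
      ≡⟨ regroup (r ^ e) j (w n′) i ⟩
    r ^ e * (i + j) + w n′
      ≤⟨ +-monoˡ-≤ (w n′) (*-monoʳ-≤ (r ^ e) i+j≤r) ⟩
    r ^ e * r + w n′
      ≡⟨ cong (_+ w n′) (*-comm (r ^ e) r) ⟩
    r ^ suc e + w n′ ∎
    where
    open ≤-Reasoning
    regroup : ∀ a b c d → (a * b + c) + a * d ≡ a * (d + b) + c
    regroup = solve-∀


  maxWeight : ℕ → ℕ
  maxWeight zero    = 0
  maxWeight (suc j) = (q ∸ 1) + r * maxWeight j

  w-<q^ : ∀ j m → m < q ^ j → w m ≤ maxWeight j
  w-<q^ zero    zero    _        = z≤n
  w-<q^ zero    (suc m) (s≤s ())
  w-<q^ (suc j) m       m<q^1+j = begin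
    w m                             ≡⟨ w-unfold m ⟩
    m % q + r * w (m / q)           ≤⟨ +-mono-≤ m%q≤q∸1 (*-monoʳ-≤ r (w-<q^ j (m / q) m/q<q^j)) ⟩
    (q ∸ 1) + r * maxWeight j       ∎
    where
    open ≤-Reasoning
    m%q≤q∸1 : m % q ≤ q ∸ 1
    m%q≤q∸1 = ≤-pred (subst (suc (m % q) ≤_) (sym (suc-pred q)) (m%n<n m q))
    m/q<q^j : m / q < q ^ j
    m/q<q^j = m<n*o⇒m/o<n (subst (m <_) (*-comm q (q ^ j)) m<q^1+j)

  maxWeight-closed : ∀ {r′} → r ≡ suc r′ → ∀ j → r′ * maxWeight j + (q ∸ 1) ≡ (q ∸ 1) * r ^ j
  maxWeight-closed {r′} refl zero    = trans (cong (_+ (q ∸ 1)) (*-zeroʳ r′)) (sym (*-identityʳ (q ∸ 1)))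
  maxWeight-closed {r′} refl (suc j) = begin
    r′ * ((q ∸ 1) + suc r′ * maxWeight j) + (q ∸ 1)  ≡⟨ regroup r′ (q ∸ 1) (maxWeight j) ⟩
    suc r′ * (r′ * maxWeight j + (q ∸ 1))            ≡⟨ cong (suc r′ *_) (maxWeight-closed refl j) ⟩
    suc r′ * ((q ∸ 1) * suc r′ ^ j)                  ≡⟨ *-comm-middle (suc r′) (q ∸ 1) (suc r′ ^ j) ⟩
    (q ∸ 1) * (suc r′ * suc r′ ^ j)                  ∎
    where
    open ≡-Reasoning
    regroup : ∀ a b c → a * (b + (1 + a) * c) + b ≡ (1 + a) * (a * c + b)
    regroup = solve-∀
    *-comm-middle : ∀ a b c → a * (b * c) ≡ b * (a * c)
    *-comm-middle = solve-∀

  log-bracket : ∀ n → .{{NonZero n}} → Σ[ L ∈ ℕ ] q ^ L ≤ n × n < q ^ suc L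
  log-bracket 1 = 0 , ≤-refl , subst (1 <_) (sym (*-identityʳ q)) 1<q
  log-bracket (suc n@(suc _)) with log-bracket n
  ... | L , q^L≤n , n<q^1+L with suc n <? q ^ suc L
  ...   | yes 1+n<q^1+L = L , m≤n⇒m≤1+n q^L≤n , 1+n<q^1+L
  ...   | no  1+n≮q^1+L = suc L , ≤-reflexive (sym 1+n≡q^1+L) , subst (_< q ^ suc (suc L)) (sym 1+n≡q^1+L) q^1+L<q^2+L
    where
    1+n≡q^1+L : suc n ≡ q ^ suc L
    1+n≡q^1+L = ≤-antisym n<q^1+L (≮⇒≥ 1+n≮q^1+L)
    q^1+L<q^2+L : q ^ suc L < q ^ suc (suc L)
    q^1+L<q^2+L = ^-monoʳ-< q 1<q (n<1+n (suc L))


module PowerBoundArithmetic (q D : ℕ) (1<q : 1 ℕ.< q) (2≤r : 2 ℕ.≤ q ℕ.∸ D) where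

  open import Data.Nat
  open import Data.Nat.Properties
  open import Data.Product using (_,_)
  open import Data.Empty using (⊥-elim)
  open import Relation.Binary.PropositionalEquality
  open import Relation.Nullary using (yes; no)
  open import Data.Nat.Tactic.RingSolver using (solve-∀)

  private
    r : ℕ
    r = q ∸ D

  open DigitWeight q r 1<q (m∸n≤m q D)

  private
    r≢0 : NonZero r
    r≢0 = >-nonZero (<-trans z<s 2≤r)

    ^-distribʳ-* : ∀ x y b → (x * y) ^ b ≡ x ^ b * y ^ b
    ^-distribʳ-* x y zero    = refl
    ^-distribʳ-* x y (suc b) = trans (cong ((x * y) *_) (^-distribʳ-* x y b)) (interchange x y (x ^ b) (y ^ b))
      where
      interchange : ∀ a c u v → (a * c) * (u * v) ≡ (a * u) * (c * v)
      interchange = solve-∀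

    r^-cancel-< : ∀ {m n} → r ^ m < r ^ n → m < n
    r^-cancel-< {m} {n} r^m<r^n with n ≤? m
    ... | yes n≤m = ⊥-elim (<⇒≱ r^m<r^n (^-monoʳ-≤ r {{r≢0}} n≤m))
    ... | no  n≰m = ≰⇒> n≰m

  exponent-bound : ∀ {X} L a b → X < (q ∸ 1) * r ^ suc L → r ^ (a + b) * (q ∸ 1) ^ b < X ^ b → a < L * b
  exponent-bound {X} L a b X< lt = +-cancelʳ-< b a (L * b) (subst (a + b <_) (+-comm b (L * b)) (r^-cancel-< r^a+b<))
    where
    r^a+b< : r ^ (a + b) < r ^ (suc L * b)
    r^a+b< = *-cancelʳ-< ((q ∸ 1) ^ b) (r ^ (a + b)) (r ^ (suc L * b)) (begin-strict
      r ^ (a + b) * (q ∸ 1) ^ b          <⟨ lt ⟩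
      X ^ b                              ≤⟨ ^-monoˡ-≤ b (<⇒≤ X<) ⟩
      ((q ∸ 1) * r ^ suc L) ^ b          ≡⟨ ^-distribʳ-* (q ∸ 1) (r ^ suc L) b ⟩
      (q ∸ 1) ^ b * (r ^ suc L) ^ b      ≡⟨ cong ((q ∸ 1) ^ b *_) (^-*-assoc r (suc L) b) ⟩
      (q ∸ 1) ^ b * r ^ (suc L * b)      ≡⟨ *-comm ((q ∸ 1) ^ b) (r ^ (suc L * b)) ⟩
      r ^ (suc L * b) * (q ∸ 1) ^ b      ∎)
      where open ≤-Reasoning

  powerBound-0 : ∀ {E N} → 1 ≤ E → N * E ≤ 0 → PowerBound q D E N 0
  powerBound-0 {E} {N} 1≤E N*E≤0 = (λ _ → N≡0) , λ a b 1≤b lt → ⊥-elim (n≮0 (subst (_ <_) (vanishes b 1≤b) lt))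
    where
    N≡0 : N ≡ 0
    N≡0 = n≤0⇒n≡0 (≤-trans (m≤m*n N E {{>-nonZero 1≤E}}) N*E≤0)
    vanishes : ∀ b → 1 ≤ b → (N * E * (r ∸ 1)) ^ b ≡ 0
    vanishes (suc b) _ rewrite N≡0 = refl

  powerBound-≥1 : ∀ {E N n} L → q ^ L ≤ n → N * E ≤ maxWeight (suc L) → PowerBound q D E N n
  powerBound-≥1 {E} {N} {n} L q^L≤n N*E≤max = n≢0 , λ a b _ lt → begin
    q ^ a             ≤⟨ ^-monoʳ-≤ q (<⇒≤ (exponent-bound L a b N*E*[r-1]< lt)) ⟩
    q ^ (L * b)       ≡⟨ ^-*-assoc q L b ⟨
    (q ^ L) ^ b       ≤⟨ ^-monoˡ-≤ b q^L≤n ⟩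
    n ^ b             ∎
    where
    open ≤-Reasoning
    n≢0 : n ≡ 0 → N ≡ 0
    n≢0 refl = ⊥-elim (<⇒≱ (m^n>0 q L) q^L≤n)
    N*E*[r-1]< : N * E * (r ∸ 1) < (q ∸ 1) * r ^ suc L
    N*E*[r-1]< = begin-strict
      N * E * (r ∸ 1)                          ≤⟨ *-monoˡ-≤ (r ∸ 1) N*E≤max ⟩
      maxWeight (suc L) * (r ∸ 1)              ≡⟨ *-comm (maxWeight (suc L)) (r ∸ 1) ⟩
      (r ∸ 1) * maxWeight (suc L)              <⟨ m<m+n _ (∸-monoˡ-< {1} {1} {q} 1<q ≤-refl) ⟩
      (r ∸ 1) * maxWeight (suc L) + (q ∸ 1)    ≡⟨ maxWeight-closed (sym (suc-pred r {{r≢0}})) (suc L) ⟩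
      (q ∸ 1) * r ^ suc L                      ∎

  powerBound : ∀ {E N} n → 1 ≤ E → (∀ V → (∀ m → m ≤ n → w m ≤ V) → N * E ≤ V) → PowerBound q D E N n
  powerBound zero        1≤E bounded = powerBound-0 1≤E (bounded 0 λ { zero _ → z≤n })
  powerBound n@(suc n-1) 1≤E bounded with log-bracket n
  ... | L , q^L≤n , n<q^1+L =
    powerBound-≥1 L q^L≤n (bounded (maxWeight (suc L)) λ m m≤n → w-<q^ (suc L) m (≤-<-trans m≤n n<q^1+L))


module PrimeBinomial where

  open import Data.Nat as ℕ using (zero; suc; _∸_; _!; _<_; NonZero)
  import Data.Nat.Properties as ℕₚ
  open import Data.Nat.Divisibility using (_∣_; divides; ∣⇒≤)
  open import Data.Nat.DivMod using (m/n*n≡m)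
  open import Data.Nat.Primality using (Prime; euclidsLemma; prime⇒nonZero; prime⇒nonTrivial)
  open import Data.Nat.Combinatorics using (_C_; nCk≡n!/k![n-k]!; k![n∸k]!∣n!)
  open import Data.Sum using (inj₁; inj₂)
  open import Data.Empty using (⊥-elim)
  open import Relation.Nullary using (¬_)
  open import Relation.Binary.PropositionalEquality as ≡ using (_≡_)

  prime∤! : ∀ {p} → Prime p → ∀ k → k < p → ¬ (p ∣ k !)
  prime∤! p-prime zero    _   p∣1 = ℕₚ.<⇒≱ (ℕ.nonTrivial⇒n>1 _ {{prime⇒nonTrivial p-prime}}) (∣⇒≤ p∣1)
  prime∤! p-prime (suc k) k<p p∣k! with euclidsLemma (suc k) (k !) p-prime p∣k!
  ... | inj₁ p∣1+k = ℕₚ.<⇒≱ k<p (∣⇒≤ p∣1+k)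
  ... | inj₂ p∣k!  = prime∤! p-prime k (ℕₚ.<-trans (ℕₚ.n<1+n k) k<p) p∣k!

  n∣n! : ∀ n → .{{NonZero n}} → n ∣ n !
  n∣n! (suc n) = divides (n !) (ℕₚ.*-comm (suc n) (n !))

  prime∣binomial : ∀ {p} → Prime p → ∀ k → 0 < k → k < p → p ∣ p C k
  prime∣binomial {p} p-prime k 0<k k<p with euclidsLemma (p C k) (k ! ℕ.* (p ∸ k) !) p-prime p∣pCk*k!*[p-k]!
    where
    pCk*k!*[p-k]!≡p! : (p C k) ℕ.* (k ! ℕ.* (p ∸ k) !) ≡ p !
    pCk*k!*[p-k]!≡p! = ≡.trans (≡.cong (ℕ._* (k ! ℕ.* (p ∸ k) !)) (nCk≡n!/k![n-k]! (ℕₚ.<⇒≤ k<p)))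
                               (m/n*n≡m {{ℕₚ._!*_!≢0 k (p ∸ k)}} (k![n∸k]!∣n! (ℕₚ.<⇒≤ k<p)))
    p∣pCk*k!*[p-k]! : p ∣ (p C k) ℕ.* (k ! ℕ.* (p ∸ k) !)
    p∣pCk*k!*[p-k]! = ≡.subst (p ∣_) (≡.sym pCk*k!*[p-k]!≡p!) (n∣n! p {{prime⇒nonZero p-prime}})
  ... | inj₁ p∣pCk = p∣pCk
  ... | inj₂ p∣k!*[p-k]! with euclidsLemma (k !) ((p ∸ k) !) p-prime p∣k!*[p-k]!
  ...   | inj₁ p∣k!     = ⊥-elim (prime∤! p-prime k k<p p∣k!)
  ...   | inj₂ p∣[p-k]! = ⊥-elim (prime∤! p-prime (p ∸ k) (ℕₚ.∸-monoʳ-< {p} {k} {0} 0<k (ℕₚ.<⇒≤ k<p)) p∣[p-k]!)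

module Frobenius {c ℓ} (R : CommutativeRing c ℓ) where

  open import Data.Nat as ℕ using (zero; suc; _∸_; NonZero)
  import Data.Nat.Properties as ℕₚ
  open import Data.Nat.Divisibility using (_∣_; divides)
  open import Data.Nat.Primality using (prime⇒nonZero)
  open import Data.Nat.Combinatorics using (_C_; nCn≡1)
  open import Data.Fin as Fin using (Fin; toℕ; inject₁; fromℕ)
  open import Data.Fin.Properties using (toℕ-inject₁; toℕ-fromℕ; toℕ<n)
  open import Data.Empty using (⊥-elim)
  open import Relation.Binary.PropositionalEquality as ≡ using (_≡_)
  import Relation.Binary.Reasoning.Setoid as SetoidReasoning
  open PrimeBinomial using (prime∣binomial)

  open CommutativeRing R hiding (zero)
  open import Algebra.Properties.Semiring.Mult semiring
  open import Algebra.Properties.Semiring.Exp semiring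
  open import Algebra.Properties.Semiring.Sum semiring
  open import Algebra.Properties.CommutativeSemiring.Binomial commutativeSemiring
  open import Data.Vec.Functional using (init; last; tail)
  open SetoidReasoning setoid

  0#^ : ∀ n → .{{NonZero n}} → 0# ^ n ≈ 0#
  0#^ (suc n) = zeroˡ _

  module Characteristic {p} (p-prime : Prime p) (char : p × 1# ≈ 0#) where

    ×-char : ∀ n x → p ∣ n → n × x ≈ 0#
    ×-char n x (divides m ≡.refl) = begin
      (m ℕ.* p) × x               ≈⟨ ×-congʳ (m ℕ.* p) (*-identityˡ x) ⟨
      (m ℕ.* p) × (1# * x)        ≈⟨ ×-assoc-* (m ℕ.* p) 1# x ⟨
      ((m ℕ.* p) × 1#) * x        ≈⟨ *-congʳ (×1-homo-* m p) ⟩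
      ((m × 1#) * (p × 1#)) * x   ≈⟨ *-congʳ (trans (*-congˡ char) (zeroʳ _)) ⟩
      0# * x                      ≈⟨ zeroˡ x ⟩
      0#                          ∎

    frobenius : ∀ x y → (x + y) ^ p ≈ x ^ p + y ^ p
    frobenius x y = expand p ≡.refl
      where
      expand : ∀ n → n ≡ p → (x + y) ^ p ≈ x ^ p + y ^ p
      expand zero    0≡p    = ⊥-elim (ℕ.≢-nonZero⁻¹ p {{prime⇒nonZero p-prime}} (≡.sym 0≡p))
      expand (suc m) ≡.refl = begin
        (x + y) ^ p                                        ≈⟨ theorem p x y ⟩
        t Fin.zero + sum (tail t)                          ≈⟨ +-congˡ (sum-init-last (tail t)) ⟩
        t Fin.zero + (sum (init (tail t)) + last (tail t)) ≈⟨ +-cong first (+-cong middle final) ⟩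
        y ^ p + (0# + x ^ p)                               ≈⟨ +-congˡ (+-identityˡ _) ⟩
        y ^ p + x ^ p                                      ≈⟨ +-comm _ _ ⟩
        x ^ p + y ^ p                                      ∎
        where
        t = binomialTerm x y p
        first : t Fin.zero ≈ y ^ p
        first = trans (+-identityʳ _) (*-identityˡ _)
        top≡p : toℕ (Fin.suc (fromℕ m)) ≡ p
        top≡p = ≡.cong suc (toℕ-fromℕ m)
        final : last (tail t) ≈ x ^ p
        final = begin
          (p C toℕ top) × (x ^ toℕ top * y ^ (p ∸ toℕ top))
            ≈⟨ ×-congˡ (≡.trans (≡.cong (p C_) top≡p) (nCn≡1 p)) ⟩
          1 × (x ^ toℕ top * y ^ (p ∸ toℕ top))
            ≈⟨ ×-homo-1 _ ⟩
          x ^ toℕ top * y ^ (p ∸ toℕ top)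
            ≈⟨ *-cong (^-congʳ x top≡p) (^-congʳ y (≡.trans (≡.cong (p ∸_) top≡p) (ℕₚ.n∸n≡0 p))) ⟩
          x ^ p * 1#
            ≈⟨ *-identityʳ _ ⟩
          x ^ p ∎
          where top = Fin.suc (fromℕ m)
        middle : sum (init (tail t)) ≈ 0#
        middle = trans (sum-cong-≋ {m} λ j → ×-char _ _ (prime∣binomial p-prime (suc (toℕ (inject₁ j))) ℕ.z<s
                         (≡.subst (ℕ._< p) (≡.sym (≡.cong suc (toℕ-inject₁ j))) (ℕ.s≤s (toℕ<n j)))))
                       (sum-replicate-zero m)

    frobenius-^ : ∀ e x y → (x + y) ^ (p ℕ.^ e) ≈ x ^ (p ℕ.^ e) + y ^ (p ℕ.^ e)
    frobenius-^ zero    x y = trans (*-identityʳ _) (sym (+-cong (*-identityʳ _) (*-identityʳ _)))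
    frobenius-^ (suc e) x y = begin
      (x + y) ^ (p ℕ.* p ℕ.^ e)                  ≈⟨ ^-assocʳ (x + y) p (p ℕ.^ e) ⟨
      ((x + y) ^ p) ^ (p ℕ.^ e)                  ≈⟨ ^-congˡ (p ℕ.^ e) (frobenius x y) ⟩
      (x ^ p + y ^ p) ^ (p ℕ.^ e)                ≈⟨ frobenius-^ e (x ^ p) (y ^ p) ⟩
      (x ^ p) ^ (p ℕ.^ e) + (y ^ p) ^ (p ℕ.^ e)  ≈⟨ +-cong (^-assocʳ x p (p ℕ.^ e)) (^-assocʳ y p (p ℕ.^ e)) ⟩
      x ^ (p ℕ.* p ℕ.^ e) + y ^ (p ℕ.* p ℕ.^ e)  ∎

    frobenius-∑ : ∀ e n (f : Fin n → Carrier) → sum f ^ (p ℕ.^ e) ≈ sum (λ i → f i ^ (p ℕ.^ e))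
    frobenius-∑ e zero    f = 0#^ (p ℕ.^ e) {{ℕₚ.m^n≢0 p e {{prime⇒nonZero p-prime}}}}
    frobenius-∑ e (suc n) f = trans (frobenius-^ e _ _) (+-congˡ (frobenius-∑ e n (λ i → f (Fin.suc i))))


module Polynomial {c ℓ} (R : CommutativeRing c ℓ) where

  open import Algebra.Structures using (IsCommutativeRing)
  open import Relation.Binary.Bundles using (Setoid)
  open import Data.Nat as ℕ using (ℕ; zero; suc; _<_; _≤_)
  import Data.Nat.Properties as ℕₚ
  open import Data.Fin as Fin using (Fin; toℕ)
  open import Data.List using ([]; _∷_; length)
  open import Data.Product using (_,_)
  open import Function using (id)
  open import Relation.Binary.PropositionalEquality as ≡ using (_≡_)
  open import Relation.Nullary using (¬_; yes; no)
  open import Data.Empty using (⊥-elim)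
  import Algebra.Properties.Ring as RingProperties
  import Algebra.Properties.CommutativeSemigroup as CommutativeSemigroupProperties
  import Algebra.Properties.Semiring.Exp as SemiringExp
  import Algebra.Properties.Semiring.Mult as SemiringMult
  import Algebra.Properties.Semiring.Sum as SemiringSum
  import Relation.Binary.Reasoning.Setoid as SetoidReasoning

  open CommutativeRing R hiding (zero)
  open ListPoly Carrier 0# _+_ _*_ -_ public
  open RingProperties ring using (-0#≈0#)
  open CommutativeSemigroupProperties +-commutativeSemigroup using (interchange)
  module ≈-Reasoning = SetoidReasoning setoid

  -- A record, unlike Polys._≈ₚ_ of Defs, so that Agda can infer f and g from an equation.
  infix 4 _≈ₚ_
  record _≈ₚ_ (f g : Pol) : Set ℓ where
    constructor coeffwise
    field coeff-≈ : ∀ i → coeff f i ≈ coeff g i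
  open _≈ₚ_ public

  ≈ₚ-refl : ∀ {f} → f ≈ₚ f
  ≈ₚ-refl = coeffwise λ _ → refl

  ≈ₚ-sym : ∀ {f g} → f ≈ₚ g → g ≈ₚ f
  ≈ₚ-sym e = coeffwise λ i → sym (coeff-≈ e i)

  ≈ₚ-trans : ∀ {f g h} → f ≈ₚ g → g ≈ₚ h → f ≈ₚ h
  ≈ₚ-trans e e′ = coeffwise λ i → trans (coeff-≈ e i) (coeff-≈ e′ i)

  ≈ₚ-reflexive : ∀ {f g} → f ≡ g → f ≈ₚ g
  ≈ₚ-reflexive ≡.refl = ≈ₚ-refl

  ≈ₚ-setoid : Setoid c ℓ
  ≈ₚ-setoid = record
    { _≈_ = _≈ₚ_
    ; isEquivalence = record { refl = ≈ₚ-refl ; sym = ≈ₚ-sym ; trans = ≈ₚ-trans }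
    }

  module ≈ₚ-Reasoning = SetoidReasoning ≈ₚ-setoid

  ∷-cong : ∀ {x y f g} → x ≈ y → f ≈ₚ g → (x ∷ f) ≈ₚ (y ∷ g)
  ∷-cong e e′ = coeffwise λ { zero → e ; (suc i) → coeff-≈ e′ i }

  ∷-tail : ∀ {x y f g} → (x ∷ f) ≈ₚ (y ∷ g) → f ≈ₚ g
  ∷-tail e = coeffwise λ i → coeff-≈ e (suc i)

  coeff-⊕ : ∀ f g i → coeff (f ⊕ g) i ≈ coeff f i + coeff g i
  coeff-⊕ []      g       i       = sym (+-identityˡ _)
  coeff-⊕ (x ∷ f) []      i       = sym (+-identityʳ _)
  coeff-⊕ (x ∷ f) (y ∷ g) zero    = refl
  coeff-⊕ (x ∷ f) (y ∷ g) (suc i) = coeff-⊕ f g i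

  coeff-neg : ∀ f i → coeff (neg f) i ≈ - coeff f i
  coeff-neg []      i       = sym -0#≈0#
  coeff-neg (x ∷ f) zero    = refl
  coeff-neg (x ∷ f) (suc i) = coeff-neg f i

  coeff-scale : ∀ a f i → coeff (scale a f) i ≈ a * coeff f i
  coeff-scale a []      i       = sym (zeroʳ a)
  coeff-scale a (x ∷ f) zero    = refl
  coeff-scale a (x ∷ f) (suc i) = coeff-scale a f i

  ⊕-cong : ∀ {f f′ g g′} → f ≈ₚ f′ → g ≈ₚ g′ → (f ⊕ g) ≈ₚ (f′ ⊕ g′)
  ⊕-cong {f} {f′} {g} {g′} e e′ = coeffwise λ i → begin
    coeff (f ⊕ g) i           ≈⟨ coeff-⊕ f g i ⟩
    coeff f i + coeff g i     ≈⟨ +-cong (coeff-≈ e i) (coeff-≈ e′ i) ⟩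
    coeff f′ i + coeff g′ i   ≈⟨ coeff-⊕ f′ g′ i ⟨
    coeff (f′ ⊕ g′) i         ∎
    where open ≈-Reasoning

  neg-cong : ∀ {f g} → f ≈ₚ g → neg f ≈ₚ neg g
  neg-cong {f} {g} e = coeffwise λ i →
    trans (coeff-neg f i) (trans (-‿cong (coeff-≈ e i)) (sym (coeff-neg g i)))

  scale-cong : ∀ {a b f g} → a ≈ b → f ≈ₚ g → scale a f ≈ₚ scale b g
  scale-cong {a} {b} {f} {g} e e′ = coeffwise λ i →
    trans (coeff-scale a f i) (trans (*-cong e (coeff-≈ e′ i)) (sym (coeff-scale b g i)))

  ⊕-assoc : ∀ f g h → ((f ⊕ g) ⊕ h) ≈ₚ (f ⊕ (g ⊕ h))
  ⊕-assoc f g h = coeffwise λ i → begin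
    coeff ((f ⊕ g) ⊕ h) i                   ≈⟨ coeff-⊕ (f ⊕ g) h i ⟩
    coeff (f ⊕ g) i + coeff h i             ≈⟨ +-congʳ (coeff-⊕ f g i) ⟩
    (coeff f i + coeff g i) + coeff h i     ≈⟨ +-assoc _ _ _ ⟩
    coeff f i + (coeff g i + coeff h i)     ≈⟨ +-congˡ (coeff-⊕ g h i) ⟨
    coeff f i + coeff (g ⊕ h) i             ≈⟨ coeff-⊕ f (g ⊕ h) i ⟨
    coeff (f ⊕ (g ⊕ h)) i                   ∎
    where open ≈-Reasoning

  ⊕-comm : ∀ f g → (f ⊕ g) ≈ₚ (g ⊕ f)
  ⊕-comm f g = coeffwise λ i → trans (coeff-⊕ f g i) (trans (+-comm _ _) (sym (coeff-⊕ g f i)))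

  ⊕-identityʳ : ∀ f → (f ⊕ []) ≈ₚ f
  ⊕-identityʳ f = coeffwise λ i → trans (coeff-⊕ f [] i) (+-identityʳ _)

  neg-inverseˡ : ∀ f → (neg f ⊕ f) ≈ₚ []
  neg-inverseˡ f = coeffwise λ i →
    trans (coeff-⊕ (neg f) f i) (trans (+-congʳ (coeff-neg f i)) (-‿inverseˡ _))

  ⊕-interchange : ∀ f g h k → ((f ⊕ g) ⊕ (h ⊕ k)) ≈ₚ ((f ⊕ h) ⊕ (g ⊕ k))
  ⊕-interchange f g h k = coeffwise λ i → begin
    coeff ((f ⊕ g) ⊕ (h ⊕ k)) i                           ≈⟨ coeff-⊕ (f ⊕ g) (h ⊕ k) i ⟩
    coeff (f ⊕ g) i + coeff (h ⊕ k) i                     ≈⟨ +-cong (coeff-⊕ f g i) (coeff-⊕ h k i) ⟩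
    (coeff f i + coeff g i) + (coeff h i + coeff k i)     ≈⟨ interchange _ _ _ _ ⟩
    (coeff f i + coeff h i) + (coeff g i + coeff k i)     ≈⟨ +-cong (coeff-⊕ f h i) (coeff-⊕ g k i) ⟨
    coeff (f ⊕ h) i + coeff (g ⊕ k) i                     ≈⟨ coeff-⊕ (f ⊕ h) (g ⊕ k) i ⟨
    coeff ((f ⊕ h) ⊕ (g ⊕ k)) i                           ∎
    where open ≈-Reasoning

  0∷-⊕ : ∀ f g → (0# ∷ (f ⊕ g)) ≈ₚ ((0# ∷ f) ⊕ (0# ∷ g))
  0∷-⊕ f g = coeffwise λ { zero → sym (+-identityˡ _) ; (suc i) → refl }

  0∷[] : (0# ∷ []) ≈ₚ []
  0∷[] = coeffwise λ { zero → refl ; (suc i) → refl }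

  ∷-split : ∀ x f → (x ∷ f) ≈ₚ ((x ∷ []) ⊕ (0# ∷ f))
  ∷-split x f = coeffwise λ { zero → sym (+-identityʳ x) ; (suc i) → refl }

  scale-⊕ : ∀ a f g → scale a (f ⊕ g) ≈ₚ (scale a f ⊕ scale a g)
  scale-⊕ a f g = coeffwise λ i → begin
    coeff (scale a (f ⊕ g)) i                   ≈⟨ coeff-scale a (f ⊕ g) i ⟩
    a * coeff (f ⊕ g) i                         ≈⟨ *-congˡ (coeff-⊕ f g i) ⟩
    a * (coeff f i + coeff g i)                 ≈⟨ distribˡ _ _ _ ⟩
    a * coeff f i + a * coeff g i               ≈⟨ +-cong (coeff-scale a f i) (coeff-scale a g i) ⟨
    coeff (scale a f) i + coeff (scale a g) i   ≈⟨ coeff-⊕ (scale a f) (scale a g) i ⟨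
    coeff (scale a f ⊕ scale a g) i             ∎
    where open ≈-Reasoning

  scale-+ : ∀ a b f → scale (a + b) f ≈ₚ (scale a f ⊕ scale b f)
  scale-+ a b f = coeffwise λ i → begin
    coeff (scale (a + b) f) i                   ≈⟨ coeff-scale (a + b) f i ⟩
    (a + b) * coeff f i                         ≈⟨ distribʳ _ _ _ ⟩
    a * coeff f i + b * coeff f i               ≈⟨ +-cong (coeff-scale a f i) (coeff-scale b f i) ⟨
    coeff (scale a f) i + coeff (scale b f) i   ≈⟨ coeff-⊕ (scale a f) (scale b f) i ⟨
    coeff (scale a f ⊕ scale b f) i             ∎
    where open ≈-Reasoning

  scale-scale : ∀ a b f → scale a (scale b f) ≈ₚ scale (a * b) f
  scale-scale a b f = coeffwise λ i → begin
    coeff (scale a (scale b f)) i   ≈⟨ coeff-scale a (scale b f) i ⟩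
    a * coeff (scale b f) i         ≈⟨ *-congˡ (coeff-scale b f i) ⟩
    a * (b * coeff f i)             ≈⟨ *-assoc _ _ _ ⟨
    (a * b) * coeff f i             ≈⟨ coeff-scale (a * b) f i ⟨
    coeff (scale (a * b) f) i       ∎
    where open ≈-Reasoning

  scale-zeroˡ : ∀ {a} f → a ≈ 0# → scale a f ≈ₚ []
  scale-zeroˡ {a} f a≈0 = coeffwise λ i → trans (coeff-scale a f i) (trans (*-congʳ a≈0) (zeroˡ _))

  scale-zeroʳ : ∀ a {f} → f ≈ₚ [] → scale a f ≈ₚ []
  scale-zeroʳ a {f} f≈0 = coeffwise λ i → trans (coeff-scale a f i) (trans (*-congˡ (coeff-≈ f≈0 i)) (zeroʳ _))

  scale-identity : ∀ f → scale 1# f ≈ₚ f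
  scale-identity f = coeffwise λ i → trans (coeff-scale 1# f i) (*-identityˡ _)

  scale-0∷ : ∀ a f → scale a (0# ∷ f) ≈ₚ (0# ∷ scale a f)
  scale-0∷ a f = coeffwise λ { zero → zeroʳ a ; (suc i) → refl }

  ⊛-zeroˡ : ∀ {f} g → f ≈ₚ [] → (f ⊛ g) ≈ₚ []
  ⊛-zeroˡ {[]}    g f≈0 = ≈ₚ-refl
  ⊛-zeroˡ {x ∷ f} g f≈0 = ≈ₚ-trans (⊕-cong (scale-zeroˡ g (coeff-≈ f≈0 zero))
    (≈ₚ-trans (∷-cong refl (⊛-zeroˡ {f} g (coeffwise λ i → coeff-≈ f≈0 (suc i)))) 0∷[])) ≈ₚ-refl

  ⊛-zeroʳ : ∀ f → (f ⊛ []) ≈ₚ []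
  ⊛-zeroʳ []      = ≈ₚ-refl
  ⊛-zeroʳ (x ∷ f) = ≈ₚ-trans (∷-cong refl (⊛-zeroʳ f)) 0∷[]

  ⊛-congˡ : ∀ {f f′} g → f ≈ₚ f′ → (f ⊛ g) ≈ₚ (f′ ⊛ g)
  ⊛-congˡ {[]}    {f′}     g e = ≈ₚ-sym (⊛-zeroˡ g (≈ₚ-sym e))
  ⊛-congˡ {x ∷ f} {[]}     g e = ⊛-zeroˡ g e
  ⊛-congˡ {x ∷ f} {x′ ∷ f′} g e =
    ⊕-cong (scale-cong (coeff-≈ e zero) ≈ₚ-refl) (∷-cong refl (⊛-congˡ g (∷-tail e)))

  ⊛-congʳ : ∀ f {g g′} → g ≈ₚ g′ → (f ⊛ g) ≈ₚ (f ⊛ g′)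
  ⊛-congʳ []      e = ≈ₚ-refl
  ⊛-congʳ (x ∷ f) e = ⊕-cong (scale-cong refl e) (∷-cong refl (⊛-congʳ f e))

  ⊛-cong : ∀ {f f′ g g′} → f ≈ₚ f′ → g ≈ₚ g′ → (f ⊛ g) ≈ₚ (f′ ⊛ g′)
  ⊛-cong {f} {f′} {g} e e′ = ≈ₚ-trans (⊛-congˡ g e) (⊛-congʳ f′ e′)

  ⊛-distribʳ : ∀ f f′ g → ((f ⊕ f′) ⊛ g) ≈ₚ ((f ⊛ g) ⊕ (f′ ⊛ g))
  ⊛-distribʳ []      f′        g = ≈ₚ-refl
  ⊛-distribʳ (x ∷ f) []        g = ≈ₚ-sym (⊕-identityʳ _)
  ⊛-distribʳ (x ∷ f) (x′ ∷ f′) g = ≈ₚ-trans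
    (⊕-cong (scale-+ x x′ g) (≈ₚ-trans (∷-cong refl (⊛-distribʳ f f′ g)) (0∷-⊕ (f ⊛ g) (f′ ⊛ g))))
    (⊕-interchange (scale x g) (scale x′ g) (0# ∷ (f ⊛ g)) (0# ∷ (f′ ⊛ g)))

  ⊛-distribˡ : ∀ f g g′ → (f ⊛ (g ⊕ g′)) ≈ₚ ((f ⊛ g) ⊕ (f ⊛ g′))
  ⊛-distribˡ []      g g′ = ≈ₚ-refl
  ⊛-distribˡ (x ∷ f) g g′ = ≈ₚ-trans
    (⊕-cong (scale-⊕ x g g′) (≈ₚ-trans (∷-cong refl (⊛-distribˡ f g g′)) (0∷-⊕ (f ⊛ g) (f ⊛ g′))))
    (⊕-interchange (scale x g) (scale x g′) (0# ∷ (f ⊛ g)) (0# ∷ (f ⊛ g′)))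

  scale-⊛ : ∀ a f g → (scale a f ⊛ g) ≈ₚ scale a (f ⊛ g)
  scale-⊛ a []      g = ≈ₚ-refl
  scale-⊛ a (x ∷ f) g = ≈ₚ-trans
    (⊕-cong (≈ₚ-sym (scale-scale a x g)) (≈ₚ-trans (∷-cong refl (scale-⊛ a f g)) (≈ₚ-sym (scale-0∷ a (f ⊛ g)))))
    (≈ₚ-sym (scale-⊕ a (scale x g) (0# ∷ (f ⊛ g))))

  ⊛-scale : ∀ a f g → (f ⊛ scale a g) ≈ₚ scale a (f ⊛ g)
  ⊛-scale a []      g = ≈ₚ-refl
  ⊛-scale a (x ∷ f) g = ≈ₚ-trans
    (⊕-cong (≈ₚ-trans (scale-scale x a g) (≈ₚ-trans (scale-cong (*-comm x a) ≈ₚ-refl) (≈ₚ-sym (scale-scale a x g))))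
            (≈ₚ-trans (∷-cong refl (⊛-scale a f g)) (≈ₚ-sym (scale-0∷ a (f ⊛ g)))))
    (≈ₚ-sym (scale-⊕ a (scale x g) (0# ∷ (f ⊛ g))))

  0∷-⊛ : ∀ f g → ((0# ∷ f) ⊛ g) ≈ₚ (0# ∷ (f ⊛ g))
  0∷-⊛ f g = ⊕-cong (scale-zeroˡ g refl) ≈ₚ-refl

  ⊛-0∷ : ∀ f g → (f ⊛ (0# ∷ g)) ≈ₚ (0# ∷ (f ⊛ g))
  ⊛-0∷ []      g = ≈ₚ-sym 0∷[]
  ⊛-0∷ (x ∷ f) g = ≈ₚ-trans (⊕-cong (scale-0∷ x g) (∷-cong refl (⊛-0∷ f g))) (≈ₚ-sym (0∷-⊕ (scale x g) (0# ∷ (f ⊛ g))))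

  ⊛-singleˡ : ∀ x g → ((x ∷ []) ⊛ g) ≈ₚ scale x g
  ⊛-singleˡ x g = ≈ₚ-trans (⊕-cong ≈ₚ-refl 0∷[]) (⊕-identityʳ _)

  ⊛-singleʳ : ∀ f y → (f ⊛ (y ∷ [])) ≈ₚ scale y f
  ⊛-singleʳ []      y = ≈ₚ-refl
  ⊛-singleʳ (x ∷ f) y = ∷-cong (trans (+-identityʳ _) (*-comm x y)) (⊛-singleʳ f y)

  ⊛-∷ : ∀ f y g → (f ⊛ (y ∷ g)) ≈ₚ (scale y f ⊕ (0# ∷ (f ⊛ g)))
  ⊛-∷ f y g = ≈ₚ-trans (⊛-congʳ f (∷-split y g))
    (≈ₚ-trans (⊛-distribˡ f _ _) (⊕-cong (⊛-singleʳ f y) (⊛-0∷ f g)))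

  ⊛-comm : ∀ f g → (f ⊛ g) ≈ₚ (g ⊛ f)
  ⊛-comm []      g       = ≈ₚ-sym (⊛-zeroʳ g)
  ⊛-comm (x ∷ f) []      = ⊛-zeroʳ (x ∷ f)
  ⊛-comm (x ∷ f) (y ∷ g) = ∷-cong (trans (+-identityʳ _) (trans (*-comm x y) (sym (+-identityʳ _)))) (begin
    scale x g ⊕ (f ⊛ (y ∷ g))
      ≈⟨ ⊕-cong ≈ₚ-refl (⊛-∷ f y g) ⟩
    scale x g ⊕ (scale y f ⊕ (0# ∷ (f ⊛ g)))
      ≈⟨ ⊕-assoc (scale x g) (scale y f) (0# ∷ (f ⊛ g)) ⟨
    (scale x g ⊕ scale y f) ⊕ (0# ∷ (f ⊛ g))
      ≈⟨ ⊕-cong (⊕-comm (scale x g) (scale y f)) (∷-cong refl (⊛-comm f g)) ⟩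
    (scale y f ⊕ scale x g) ⊕ (0# ∷ (g ⊛ f))
      ≈⟨ ⊕-assoc (scale y f) (scale x g) (0# ∷ (g ⊛ f)) ⟩
    scale y f ⊕ (scale x g ⊕ (0# ∷ (g ⊛ f)))
      ≈⟨ ⊕-cong ≈ₚ-refl (⊛-∷ g x f) ⟨
    scale y f ⊕ (g ⊛ (x ∷ f)) ∎)
    where open ≈ₚ-Reasoning

  ⊛-assoc : ∀ f g h → ((f ⊛ g) ⊛ h) ≈ₚ (f ⊛ (g ⊛ h))
  ⊛-assoc []      g h = ≈ₚ-refl
  ⊛-assoc (x ∷ f) g h = ≈ₚ-trans (⊛-distribʳ (scale x g) (0# ∷ (f ⊛ g)) h)
    (⊕-cong (scale-⊛ x g h) (≈ₚ-trans (0∷-⊛ (f ⊛ g) h) (∷-cong refl (⊛-assoc f g h))))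

  ⊛-identityˡ : ∀ g → ((1# ∷ []) ⊛ g) ≈ₚ g
  ⊛-identityˡ g = ≈ₚ-trans (⊛-singleˡ 1# g) (scale-identity g)

  polyRing : CommutativeRing c ℓ
  polyRing = record { isCommutativeRing = ring-laws }
    where
    ring-laws : IsCommutativeRing _≈ₚ_ _⊕_ _⊛_ neg [] (1# ∷ [])
    ring-laws = record
      { isRing = record
        { +-isAbelianGroup = record
          { isGroup = record
            { isMonoid = record
              { isSemigroup = record
                { isMagma = record { isEquivalence = Setoid.isEquivalence ≈ₚ-setoid ; ∙-cong = ⊕-cong }
                ; assoc = ⊕-assoc }
              ; identity = (λ _ → ≈ₚ-refl) , ⊕-identityʳ }
            ; inverse = neg-inverseˡ , (λ f → ≈ₚ-trans (⊕-comm f (neg f)) (neg-inverseˡ f))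
            ; ⁻¹-cong = neg-cong }
          ; comm = ⊕-comm }
        ; *-cong = ⊛-cong
        ; *-assoc = ⊛-assoc
        ; *-identity = ⊛-identityˡ , (λ g → ≈ₚ-trans (⊛-comm g _) (⊛-identityˡ g))
        ; distrib = ⊛-distribˡ , (λ h f g → ⊛-distribʳ f g h) }
      ; *-comm = ⊛-comm }

  module Ringₚ = CommutativeRing polyRing
  open SemiringExp semiring public using (_^_)
  open SemiringExp Ringₚ.semiring public using () renaming (_^_ to _^ₚ_)
  open SemiringMult semiring public using (_×_)
  open SemiringMult Ringₚ.semiring public using () renaming (_×_ to _×ₚ_)
  open SemiringSum Ringₚ.semiring public using ()
    renaming (sum-syntax to ∑ₚ; sum-cong-≋ to ∑ₚ-cong; *-distribˡ-sum to ⊛-distribˡ-∑ₚ; *-distribʳ-sum to ⊛-distribʳ-∑ₚ)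

  C : Carrier → Pol
  C x = x ∷ []

  var : Pol
  var = 0# ∷ 1# ∷ []

  shift : ℕ → Pol → Pol
  shift zero    f = f
  shift (suc n) f = 0# ∷ shift n f

  C-cong : ∀ {x y} → x ≈ y → C x ≈ₚ C y
  C-cong e = ∷-cong e ≈ₚ-refl

  C-0 : C 0# ≈ₚ []
  C-0 = coeffwise λ { zero → refl ; (suc i) → refl }

  C-^ : ∀ x n → (C x ^ₚ n) ≈ₚ C (x ^ n)
  C-^ x zero    = ≈ₚ-refl
  C-^ x (suc n) = ≈ₚ-trans (⊛-congʳ (C x) (C-^ x n)) (⊛-singleˡ x (C (x ^ n)))

  C-× : ∀ n x → (n ×ₚ C x) ≈ₚ C (n × x)
  C-× zero    x = ≈ₚ-sym C-0
  C-× (suc n) x = ⊕-cong (≈ₚ-refl {C x}) (C-× n x)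

  coeff-shift-< : ∀ b {f i} → i < b → coeff (shift b f) i ≡ 0#
  coeff-shift-< (suc b) {i = zero}  _            = ≡.refl
  coeff-shift-< (suc b) {i = suc i} (ℕ.s≤s i<b) = coeff-shift-< b i<b

  coeff-shift-+ : ∀ b {f} i → coeff (shift b f) (b ℕ.+ i) ≡ coeff f i
  coeff-shift-+ zero    i = ≡.refl
  coeff-shift-+ (suc b) i = coeff-shift-+ b i

  shift-cong : ∀ n {f g} → f ≈ₚ g → shift n f ≈ₚ shift n g
  shift-cong zero    e = e
  shift-cong (suc n) e = ∷-cong refl (shift-cong n e)

  shift-[] : ∀ n → shift n [] ≈ₚ []
  shift-[] zero    = ≈ₚ-refl
  shift-[] (suc n) = ≈ₚ-trans (∷-cong refl (shift-[] n)) 0∷[]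

  shift-⊕ : ∀ n f g → shift n (f ⊕ g) ≈ₚ (shift n f ⊕ shift n g)
  shift-⊕ zero    f g = ≈ₚ-refl
  shift-⊕ (suc n) f g = ≈ₚ-trans (∷-cong refl (shift-⊕ n f g)) (0∷-⊕ (shift n f) (shift n g))

  shift-scale : ∀ n a f → shift n (scale a f) ≈ₚ scale a (shift n f)
  shift-scale zero    a f = ≈ₚ-refl
  shift-scale (suc n) a f = ≈ₚ-trans (∷-cong refl (shift-scale n a f)) (≈ₚ-sym (scale-0∷ a (shift n f)))

  shift-0∷ : ∀ n f → shift n (0# ∷ f) ≡ shift (suc n) f
  shift-0∷ zero    f = ≡.refl
  shift-0∷ (suc n) f = ≡.cong (0# ∷_) (shift-0∷ n f)

  var^-⊛ : ∀ n g → ((var ^ₚ n) ⊛ g) ≈ₚ shift n g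
  var^-⊛ zero    g = ⊛-identityˡ g
  var^-⊛ (suc n) g = ≈ₚ-trans (⊛-assoc var (var ^ₚ n) g)
    (≈ₚ-trans (⊕-cong (scale-zeroˡ _ refl) (∷-cong refl (⊛-identityˡ _))) (∷-cong refl (var^-⊛ n g)))

  monomial-⊛ : ∀ x n g → ((C x ⊛ (var ^ₚ n)) ⊛ g) ≈ₚ scale x (shift n g)
  monomial-⊛ x n g = ≈ₚ-trans (⊛-assoc (C x) (var ^ₚ n) g)
    (≈ₚ-trans (⊛-singleˡ x ((var ^ₚ n) ⊛ g)) (scale-cong refl (var^-⊛ n g)))

  ∑-monomials : ∀ f → f ≈ₚ ∑ₚ (length f) (λ i → C (coeff f (toℕ i)) ⊛ (var ^ₚ toℕ i))
  ∑-monomials []      = ≈ₚ-refl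
  ∑-monomials (x ∷ f) = begin
    x ∷ f
      ≈⟨ ∷-split x f ⟩
    C x ⊕ (0# ∷ f)
      ≈⟨ ⊕-cong (Ringₚ.*-identityʳ (C x)) (var^-⊛ 1 f) ⟨
    (C x ⊛ (var ^ₚ 0)) ⊕ ((var ^ₚ 1) ⊛ f)
      ≈⟨ ⊕-cong (≈ₚ-refl {C x ⊛ (var ^ₚ 0)}) (⊛-congʳ (var ^ₚ 1) (∑-monomials f)) ⟩
    (C x ⊛ (var ^ₚ 0)) ⊕ ((var ^ₚ 1) ⊛ ∑ₚ n (λ i → monomial i))
      ≈⟨ ⊕-cong (≈ₚ-refl {C x ⊛ (var ^ₚ 0)}) (⊛-distribˡ-∑ₚ (var ^ₚ 1) (λ i → monomial i)) ⟩
    (C x ⊛ (var ^ₚ 0)) ⊕ ∑ₚ n (λ i → (var ^ₚ 1) ⊛ monomial i)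
      ≈⟨ ⊕-cong (≈ₚ-refl {C x ⊛ (var ^ₚ 0)}) (∑ₚ-cong {n} λ i → shuffle (coeff f (toℕ i)) (toℕ i)) ⟩
    (C x ⊛ (var ^ₚ 0)) ⊕ ∑ₚ n (λ i → C (coeff f (toℕ i)) ⊛ (var ^ₚ suc (toℕ i))) ∎
    where
    open ≈ₚ-Reasoning
    n = length f
    monomial : Fin n → Pol
    monomial i = C (coeff f (toℕ i)) ⊛ (var ^ₚ toℕ i)
    shuffle : ∀ y k → ((var ^ₚ 1) ⊛ (C y ⊛ (var ^ₚ k))) ≈ₚ (C y ⊛ (var ^ₚ suc k))
    shuffle y k = begin
      (var ^ₚ 1) ⊛ (C y ⊛ (var ^ₚ k))     ≈⟨ ⊛-assoc (var ^ₚ 1) (C y) (var ^ₚ k) ⟨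
      ((var ^ₚ 1) ⊛ C y) ⊛ (var ^ₚ k)     ≈⟨ ⊛-congˡ (var ^ₚ k) (⊛-comm (var ^ₚ 1) (C y)) ⟩
      (C y ⊛ (var ^ₚ 1)) ⊛ (var ^ₚ k)     ≈⟨ ⊛-assoc (C y) (var ^ₚ 1) (var ^ₚ k) ⟩
      C y ⊛ ((var ^ₚ 1) ⊛ (var ^ₚ k))     ≈⟨ ⊛-congʳ (C y) (⊛-congˡ (var ^ₚ k) (Ringₚ.*-identityʳ var)) ⟩
      C y ⊛ (var ^ₚ suc k)                ∎

  infix 4 Deg[_]_+_≤_ Deg_+_≤_

  -- The offset s lets weight bounds be shifted without truncated subtraction.
  record Deg[_]_+_≤_ (wt : ℕ → ℕ) (f : Pol) (s m : ℕ) : Set ℓ where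
    constructor deg≤
    field vanish : ∀ i → m < wt i ℕ.+ s → coeff f i ≈ 0#
  open Deg[_]_+_≤_ public

  Deg_+_≤_ : Pol → ℕ → ℕ → Set ℓ
  Deg f + s ≤ m = Deg[ id ] f + s ≤ m

  module _ {wt : ℕ → ℕ} where

    deg-cong : ∀ {f g s m} → f ≈ₚ g → Deg[ wt ] f + s ≤ m → Deg[ wt ] g + s ≤ m
    deg-cong f≈g bound = deg≤ λ i lt → trans (sym (coeff-≈ f≈g i)) (vanish bound i lt)

    deg-zero : ∀ {f s m} → f ≈ₚ [] → Deg[ wt ] f + s ≤ m
    deg-zero f≈0 = deg≤ λ i _ → coeff-≈ f≈0 i

    deg-weaken : ∀ {f s m m′} → m ℕ.≤ m′ → Deg[ wt ] f + s ≤ m → Deg[ wt ] f + s ≤ m′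
    deg-weaken m≤m′ bound = deg≤ λ i lt → vanish bound i (ℕₚ.≤-<-trans m≤m′ lt)

    deg-nonzero : ∀ {f s m} → ¬ (f ≈ₚ []) → Deg[ wt ] f + s ≤ m → s ℕ.≤ m
    deg-nonzero {f} {s} {m} f≉0 bound with s ℕₚ.≤? m
    ... | yes s≤m = s≤m
    ... | no  s≰m = ⊥-elim (f≉0 (coeffwise λ i → vanish bound i (ℕₚ.<-≤-trans (ℕₚ.≰⇒> s≰m) (ℕₚ.m≤n+m s (wt i)))))

    deg-offset : ∀ {f s m e V} → Deg[ wt ] f + s ≤ m → m ℕ.+ e ℕ.≤ V → Deg[ wt ] f + (e ℕ.+ s) ≤ V
    deg-offset {f} {s} {m} {e} {V} bound m+e≤V = deg≤ λ i lt → vanish bound i (ℕₚ.+-cancelʳ-< e m (wt i ℕ.+ s)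
      (ℕₚ.≤-<-trans m+e≤V (≡.subst (V <_) (regroup (wt i) e s) lt)))
      where
      regroup : ∀ a b c → a ℕ.+ (b ℕ.+ c) ≡ (a ℕ.+ c) ℕ.+ b
      regroup a b c = ≡.trans (≡.cong (a ℕ.+_) (ℕₚ.+-comm b c)) (≡.sym (ℕₚ.+-assoc a c b))

    deg-⊕ : ∀ {f g s m} → Deg[ wt ] f + s ≤ m → Deg[ wt ] g + s ≤ m → Deg[ wt ] f ⊕ g + s ≤ m
    deg-⊕ {f} {g} bf bg = deg≤ λ i lt →
      trans (coeff-⊕ f g i) (trans (+-cong (vanish bf i lt) (vanish bg i lt)) (+-identityˡ 0#))

    deg-neg : ∀ {f s m} → Deg[ wt ] f + s ≤ m → Deg[ wt ] neg f + s ≤ m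
    deg-neg {f} bound = deg≤ λ i lt → trans (coeff-neg f i) (trans (-‿cong (vanish bound i lt)) -0#≈0#)

    deg-scale : ∀ {f s m} x → Deg[ wt ] f + s ≤ m → Deg[ wt ] scale x f + s ≤ m
    deg-scale {f} x bound = deg≤ λ i lt → trans (coeff-scale x f i) (trans (*-congˡ (vanish bound i lt)) (zeroʳ x))

    deg-∑ : ∀ {s m} n (g : Fin n → Pol) → (∀ i → Deg[ wt ] g i + s ≤ m) → Deg[ wt ] ∑ₚ n g + s ≤ m
    deg-∑ zero    g bounds = deg-zero ≈ₚ-refl
    deg-∑ (suc n) g bounds = deg-⊕ (bounds Fin.zero) (deg-∑ n (λ i → g (Fin.suc i)) (λ i → bounds (Fin.suc i)))

    deg-shift : (∀ a b → wt (a ℕ.+ b) ℕ.≤ wt a ℕ.+ wt b) →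
                ∀ {f s m} b → Deg[ wt ] f + s ≤ m → Deg[ wt ] shift b f + s ≤ m ℕ.+ wt b
    deg-shift subadditive {f} {s} {m} b bound = deg≤ vanishing
      where
      vanishing : ∀ i → m ℕ.+ wt b < wt i ℕ.+ s → coeff (shift b f) i ≈ 0#
      vanishing i lt with i ℕₚ.<? b
      ... | yes i<b = reflexive (coeff-shift-< b i<b)
      ... | no  i≮b = ≡.subst (λ k → coeff (shift b f) k ≈ 0#) (ℕₚ.m+[n∸m]≡n b≤i)
                        (trans (reflexive (coeff-shift-+ b (i ℕ.∸ b))) (vanish bound (i ℕ.∸ b) lt′))
        where
        b≤i = ℕₚ.≮⇒≥ i≮b
        wt-i≤ : wt i ℕ.≤ wt b ℕ.+ wt (i ℕ.∸ b)
        wt-i≤ = ≡.subst (λ k → wt k ℕ.≤ wt b ℕ.+ wt (i ℕ.∸ b)) (ℕₚ.m+[n∸m]≡n b≤i) (subadditive b (i ℕ.∸ b))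
        lt′ : m < wt (i ℕ.∸ b) ℕ.+ s
        lt′ = ℕₚ.+-cancelˡ-< (wt b) m (wt (i ℕ.∸ b) ℕ.+ s) (begin-strict
          wt b ℕ.+ m                   ≡⟨ ℕₚ.+-comm (wt b) m ⟩
          m ℕ.+ wt b                   <⟨ lt ⟩
          wt i ℕ.+ s                   ≤⟨ ℕₚ.+-monoˡ-≤ s wt-i≤ ⟩
          wt b ℕ.+ wt (i ℕ.∸ b) ℕ.+ s  ≡⟨ ℕₚ.+-assoc (wt b) _ s ⟩
          wt b ℕ.+ (wt (i ℕ.∸ b) ℕ.+ s) ∎)
          where open ℕₚ.≤-Reasoning

  deg-0∷ : ∀ {f s m} → Deg f + suc s ≤ m → Deg (0# ∷ f) + s ≤ m
  deg-0∷ {f} {s} {m} bound = deg≤ λ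
    { zero    _  → refl
    ; (suc i) lt → vanish bound i (≡.subst (m <_) (≡.sym (ℕₚ.+-suc i s)) lt) }

  deg-tail : ∀ {x f s m} → Deg (x ∷ f) + s ≤ m → Deg f + suc s ≤ m
  deg-tail {s = s} {m} bound = deg≤ λ i lt → vanish bound (suc i) (≡.subst (m <_) (ℕₚ.+-suc i s) lt)

  deg-scaleC : ∀ {x f s s′ m m′} → Deg C x + s ≤ m → Deg f + s′ ≤ m′ → Deg scale x f + (s ℕ.+ s′) ≤ m ℕ.+ m′
  deg-scaleC {x} {f} {s} {s′} {m} {m′} bx bf = deg≤ vanishing
    where
    vanishing : ∀ i → m ℕ.+ m′ < i ℕ.+ (s ℕ.+ s′) → coeff (scale x f) i ≈ 0#
    vanishing i lt with m ℕₚ.<? s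
    ... | yes m<s = trans (coeff-scale x f i) (trans (*-congʳ (vanish bx 0 m<s)) (zeroˡ _))
    ... | no  m≮s = trans (coeff-scale x f i) (trans (*-congˡ (vanish bf i lt′)) (zeroʳ _))
      where
      open ℕₚ.≤-Reasoning
      lt′ : m′ < i ℕ.+ s′
      lt′ = ℕₚ.+-cancelˡ-< s m′ (i ℕ.+ s′) (begin-strict
        s ℕ.+ m′             ≤⟨ ℕₚ.+-monoˡ-≤ m′ (ℕₚ.≮⇒≥ m≮s) ⟩
        m ℕ.+ m′             <⟨ lt ⟩
        i ℕ.+ (s ℕ.+ s′)     ≡⟨ ℕₚ.+-comm i (s ℕ.+ s′) ⟩
        s ℕ.+ s′ ℕ.+ i       ≡⟨ ℕₚ.+-assoc s s′ i ⟩
        s ℕ.+ (s′ ℕ.+ i)     ≡⟨ ≡.cong (s ℕ.+_) (ℕₚ.+-comm s′ i) ⟩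
        s ℕ.+ (i ℕ.+ s′)     ∎)

  deg-⊛ : ∀ f {g s s′ m m′} → Deg f + s ≤ m → Deg g + s′ ≤ m′ → Deg f ⊛ g + (s ℕ.+ s′) ≤ m ℕ.+ m′
  deg-⊛ []      bf bg = deg-zero ≈ₚ-refl
  deg-⊛ (x ∷ f) {s = s} {m = m} bf bg = deg-⊕ (deg-scaleC head bg) (deg-0∷ (deg-⊛ f (deg-tail bf) bg))
    where
    head : Deg C x + s ≤ m
    head = deg≤ λ { zero lt → vanish bf 0 lt ; (suc _) _ → refl }



module PolynomialFrobenius {c ℓ} (R : CommutativeRing c ℓ) where

  open import Data.Nat as ℕ using (ℕ)
  open import Data.Fin using (toℕ)
  open import Data.List using ([]; length)
  import Algebra.Properties.Semiring.Exp as SemiringExp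
  import Algebra.Properties.CommutativeSemiring.Exp as CommutativeSemiringExp
  open CommutativeRing R using (1#; 0#; _≈_)
  open Polynomial R
  open SemiringExp Ringₚ.semiring using (^-congˡ; ^-assocʳ)
  open CommutativeSemiringExp Ringₚ.commutativeSemiring using (^-distrib-*)
  private module FrobeniusPoly = Frobenius polyRing

  module Characteristic {p} (p-prime : Prime p) (char : p × 1# ≈ 0#) where

    char-poly : p ×ₚ C 1# ≈ₚ []
    char-poly = ≈ₚ-trans (C-× p 1#) (≈ₚ-trans (C-cong char) C-0)

    open FrobeniusPoly.Characteristic p-prime char-poly public using ()
      renaming (frobenius-^ to frobeniusₚ-^; frobenius-∑ to frobeniusₚ-∑)

    frobenius-monomials : ∀ e f →
      (f ^ₚ (p ℕ.^ e)) ≈ₚ ∑ₚ (length f) (λ i → C (coeff f (toℕ i) ^ (p ℕ.^ e)) ⊛ (var ^ₚ (toℕ i ℕ.* p ℕ.^ e)))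
    frobenius-monomials e f = begin
      f ^ₚ pᵉ
        ≈⟨ ^-congˡ pᵉ (∑-monomials f) ⟩
      ∑ₚ n (λ i → C (coeff f (toℕ i)) ⊛ (var ^ₚ toℕ i)) ^ₚ pᵉ
        ≈⟨ frobeniusₚ-∑ e n _ ⟩
      ∑ₚ n (λ i → (C (coeff f (toℕ i)) ⊛ (var ^ₚ toℕ i)) ^ₚ pᵉ)
        ≈⟨ ∑ₚ-cong {n} (λ i → monomial-^ (coeff f (toℕ i)) (toℕ i)) ⟩
      ∑ₚ n (λ i → C (coeff f (toℕ i) ^ pᵉ) ⊛ (var ^ₚ (toℕ i ℕ.* pᵉ))) ∎
      where
      open ≈ₚ-Reasoning
      pᵉ = p ℕ.^ e
      n = length f
      monomial-^ : ∀ x i → ((C x ⊛ (var ^ₚ i)) ^ₚ pᵉ) ≈ₚ (C (x ^ pᵉ) ⊛ (var ^ₚ (i ℕ.* pᵉ)))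
      monomial-^ x i = ≈ₚ-trans (^-distrib-* (C x) (var ^ₚ i) pᵉ) (⊛-cong (C-^ x pᵉ) (^-assocʳ var i pᵉ))


module Bivariate {c ℓ} (R : CommutativeRing c ℓ) where

  open import Data.Nat as ℕ using (ℕ; zero; suc; _<_)
  import Data.Nat.Properties as ℕₚ
  open import Data.List using ([]; _∷_)
  open import Relation.Binary.PropositionalEquality as ≡ using (_≡_)

  open CommutativeRing R using (Carrier; 0#; 1#; refl)
  module Y = Polynomial R
  module X = Polynomial Y.polyRing
  open Y using (Deg_+_≤_; deg≤)

  infix 4 TotDeg_+_≤_

  record TotDeg_+_≤_ (A : X.Pol) (s m : ℕ) : Set ℓ where
    constructor totDeg≤
    field coefficient : ∀ j → Deg X.coeff A j + (j ℕ.+ s) ≤ m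
  open TotDeg_+_≤_ public

  X+cy : Carrier → X.Pol
  X+cy a = (0# ∷ a ∷ []) ∷ (1# ∷ []) ∷ []

  totDeg-⊕ : ∀ {A B s m} → TotDeg A + s ≤ m → TotDeg B + s ≤ m → TotDeg A X.⊕ B + s ≤ m
  totDeg-⊕ {A} {B} bA bB = totDeg≤ λ j →
    Y.deg-cong (Y.≈ₚ-sym (X.coeff-⊕ A B j)) (Y.deg-⊕ (coefficient bA j) (coefficient bB j))

  totDeg-scale : ∀ {g B s s′ m m′} → Deg g + s ≤ m → TotDeg B + s′ ≤ m′ → TotDeg X.scale g B + (s ℕ.+ s′) ≤ m ℕ.+ m′
  totDeg-scale {g} {B} {s} {s′} {m} {m′} bg bB = totDeg≤ λ j →
    Y.deg-cong (Y.≈ₚ-sym (X.coeff-scale g B j))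
      (≡.subst (λ t → Deg g Y.⊛ X.coeff B j + t ≤ m ℕ.+ m′) (swap s j s′) (Y.deg-⊛ g bg (coefficient bB j)))
    where
    swap : ∀ a b c → a ℕ.+ (b ℕ.+ c) ≡ b ℕ.+ (a ℕ.+ c)
    swap a b c = ≡.trans (≡.sym (ℕₚ.+-assoc a b c)) (≡.trans (≡.cong (ℕ._+ c) (ℕₚ.+-comm a b)) (ℕₚ.+-assoc b a c))

  totDeg-0∷ : ∀ {A s m} → TotDeg A + suc s ≤ m → TotDeg ([] ∷ A) + s ≤ m
  totDeg-0∷ {A} {s} {m} bA = totDeg≤ λ
    { zero    → Y.deg-zero Y.≈ₚ-refl
    ; (suc j) → ≡.subst (λ t → Deg X.coeff A j + t ≤ m) (ℕₚ.+-suc j s) (coefficient bA j) }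

  totDeg-tail : ∀ {g A s m} → TotDeg (g ∷ A) + s ≤ m → TotDeg A + suc s ≤ m
  totDeg-tail {g} {A} {s} {m} bA = totDeg≤ λ j →
    ≡.subst (λ t → Deg X.coeff A j + t ≤ m) (≡.sym (ℕₚ.+-suc j s)) (coefficient bA (suc j))

  totDeg-⊛ : ∀ A {B s s′ m m′} → TotDeg A + s ≤ m → TotDeg B + s′ ≤ m′ → TotDeg A X.⊛ B + (s ℕ.+ s′) ≤ m ℕ.+ m′
  totDeg-⊛ []      bA bB = totDeg≤ λ j → Y.deg-zero Y.≈ₚ-refl
  totDeg-⊛ (g ∷ A) bA bB = totDeg-⊕ (totDeg-scale (coefficient bA 0) bB) (totDeg-0∷ (totDeg-⊛ A (totDeg-tail bA) bB))

  totDeg-1 : TotDeg X.C (Y.C 1#) + 0 ≤ 0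
  totDeg-1 = totDeg≤ λ
    { zero    → deg≤ λ { zero () ; (suc i) _ → refl }
    ; (suc j) → deg≤ λ _ _ → refl }

  totDeg-X+cy : ∀ a → TotDeg X+cy a + 0 ≤ 1
  totDeg-X+cy a = totDeg≤ λ
    { zero          → deg≤ λ { zero () ; (suc zero) (ℕ.s≤s ()) ; (suc (suc i)) _ → refl }
    ; (suc zero)    → deg≤ λ { zero (ℕ.s≤s ()) ; (suc i) _ → refl }
    ; (suc (suc j)) → deg≤ λ _ _ → refl }

  totDeg-^ : ∀ a n → TotDeg X+cy a X.^ₚ n + 0 ≤ n
  totDeg-^ a zero    = totDeg-1
  totDeg-^ a (suc n) = totDeg-⊛ (X+cy a) (totDeg-X+cy a) (totDeg-^ a n)


m<n+o⇒m-o<n : ∀ {m n o} → m ℕ.< n ℕ.+ o → ℤ.+ m ℤ.- ℤ.+ o ℤ.< ℤ.+ n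
m<n+o⇒m-o<n {m} {n} {o} lt = ≡.subst₂ ℤ._<_ (≡.sym (ℤₚ.m-n≡m⊖n m o)) n+o⊖o≡n (ℤₚ.⊖-monoˡ-< o lt)
  where
  n+o⊖o≡n : (n ℕ.+ o) ℤ.⊖ o ≡ ℤ.+ n
  n+o⊖o≡n = ≡.trans (ℤₚ.⊖-≥ (ℕₚ.m≤n+m o n)) (≡.cong ℤ.+_ (ℕₚ.m+n∸n≡m n o))

module OverField {c ℓ} (F : Field c ℓ) where

  open import Data.Nat as ℕ using (zero; suc; _∸_; _<_; _≤_)
  import Data.Nat.Properties as ℕₚ
  open import Data.Nat.Induction using (<-rec)
  open import Data.Nat.Primality using (prime⇒nonZero)
  open import Data.Integer using (+_) renaming (_-_ to _-ℤ_)
  open import Data.List using ([]; _∷_; length; map; reverse; _++_)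
  import Data.List.Properties as Listₚ
  import Data.Vec as Vec
  import Data.Vec.Properties as Vecₚ
  open import Data.Fin using (Fin; toℕ)
  open import Data.Product using (_,_)
  open import Data.Empty using (⊥-elim)
  open import Relation.Nullary using (yes; no)
  open import Relation.Binary.PropositionalEquality as ≡ using (_≡_)
  import Algebra.Properties.Ring as RingProperties
  import Algebra.Properties.Semiring.Exp as SemiringExp
  import Algebra.Properties.CommutativeSemiring.Exp as CommutativeSemiringExp

  open Field F using (Carrier; commRing; semiring; _≈_; _+_; 0#; 1#; refl; sym; trans; reflexive; zeroʳ; *-identityʳ)
  open Polys F using (yPow; DegAtMost; IsLinear; iter; companion; SatisfiesRecursion; natToF; powX; XplusCy)
  module Y = Polynomial commRing
  open Y
  open RingProperties Ringₚ.ring using (-‿distribˡ-*; -‿+-comm; +-inverseˡ-unique)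
  module X = Polynomial polyRing

  yPow-degree : ∀ n → DegAtMost (yPow n) (+ n)
  yPow-degree n i (ℤ.+<+ n<i) = reflexive (coeff-yPow n i n<i)
    where
    coeff-yPow : ∀ n i → n < i → coeff (yPow n) i ≡ 0#
    coeff-yPow zero    (suc i) _           = ≡.refl
    coeff-yPow (suc n) (suc i) (ℕ.s≤s n<i) = coeff-yPow n i n<i

  weight-of-degree : ∀ {wt f n V} → DegAtMost f (+ n) → (∀ m → m ≤ n → wt m ≤ V) → Deg[ wt ] f + 0 ≤ V
  weight-of-degree {wt} {f} {n} {V} deg-f wt≤V = deg≤ vanishing
    where
    vanishing : ∀ m → V < wt m ℕ.+ 0 → coeff f m ≈ 0#
    vanishing m V<wtₘ with m ℕₚ.≤? n
    ... | yes m≤n = ⊥-elim (ℕₚ.<⇒≱ (≡.subst (V <_) (ℕₚ.+-identityʳ (wt m)) V<wtₘ) (wt≤V m m≤n))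
    ... | no  m≰n = deg-f m (ℤ.+<+ (ℕₚ.≰⇒> m≰n))

  shift-yPow : ∀ n m → shift n (yPow m) ≡ yPow (n ℕ.+ m)
  shift-yPow zero    m = ≡.refl
  shift-yPow (suc n) m = ≡.cong (0# ∷_) (shift-yPow n m)

  shift-∷ : ∀ m x g → shift m (x ∷ g) ≈ₚ (scale x (yPow m) ⊕ shift (suc m) g)
  shift-∷ m x g = begin
    shift m (x ∷ g)                               ≈⟨ shift-cong m (∷-split x g) ⟩
    shift m (C x ⊕ (0# ∷ g))                      ≈⟨ shift-⊕ m (C x) (0# ∷ g) ⟩
    shift m (C x) ⊕ shift m (0# ∷ g)              ≈⟨ ⊕-cong (shift-cong m x≈x·1) (≈ₚ-reflexive (shift-0∷ m g)) ⟩
    shift m (scale x (C 1#)) ⊕ shift (suc m) g    ≈⟨ ⊕-cong (shift-scale m x (C 1#)) ≈ₚ-refl ⟩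
    scale x (shift m (C 1#)) ⊕ shift (suc m) g    ≈⟨ ⊕-cong (≈ₚ-reflexive (≡.cong (scale x) (shift-C1 m))) ≈ₚ-refl ⟩
    scale x (yPow m) ⊕ shift (suc m) g            ∎
    where
    open ≈ₚ-Reasoning
    x≈x·1 : C x ≈ₚ scale x (C 1#)
    x≈x·1 = C-cong (sym (*-identityʳ x))
    shift-C1 : ∀ m → shift m (C 1#) ≡ yPow m
    shift-C1 zero    = ≡.refl
    shift-C1 (suc m) = ≡.cong (0# ∷_) (shift-C1 m)

  module _ {U : Pol → Pol} (U-linear : IsLinear U) where

    open IsLinear U-linear

    U-cong : ∀ {f g} → f ≈ₚ g → U f ≈ₚ U g
    U-cong {f} {g} f≈g = coeffwise (cong f g (coeff-≈ f≈g))

    U-⊕ : ∀ f g → U (f ⊕ g) ≈ₚ (U f ⊕ U g)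
    U-⊕ f g = coeffwise (additive f g)

    U-scale : ∀ a f → U (scale a f) ≈ₚ scale a (U f)
    U-scale a f = coeffwise (homogeneous a f)

    U-zero : ∀ {f} → f ≈ₚ [] → U f ≈ₚ []
    U-zero f≈0 = ≈ₚ-trans (U-cong f≈0) (≈ₚ-trans (U-scale 0# []) (scale-zeroˡ (U []) refl))

    U-shift-∷ : ∀ m x g → U (shift m (x ∷ g)) ≈ₚ (scale x (U (yPow m)) ⊕ U (shift (suc m) g))
    U-shift-∷ m x g = ≈ₚ-trans (U-cong (shift-∷ m x g))
      (≈ₚ-trans (U-⊕ (scale x (yPow m)) (shift (suc m) g)) (⊕-cong (U-scale x (yPow m)) ≈ₚ-refl))

    U-monomials : (∀ m → U (yPow m) ≈ₚ []) → ∀ h → U h ≈ₚ []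
    U-monomials U-yᵐ≈0 h = vanishing h 0
      where
      vanishing : ∀ h m → U (shift m h) ≈ₚ []
      vanishing []      m = U-zero (shift-[] m)
      vanishing (x ∷ h) m = ≈ₚ-trans (U-shift-∷ m x h) (⊕-cong (scale-zeroʳ x (U-yᵐ≈0 m)) (vanishing h (suc m)))

    module _ {wt : ℕ → ℕ} {E} (lowers : ∀ m → Deg[ wt ] U (yPow m) + E ≤ wt m) where

      U-lowers-weight : ∀ {g e V} → Deg[ wt ] g + e ≤ V → Deg[ wt ] U g + (e ℕ.+ E) ≤ V
      U-lowers-weight {e = e} {V} = shifted _ 0
        where
        shifted : ∀ g m → Deg[ (λ j → wt (m ℕ.+ j)) ] g + e ≤ V → Deg[ wt ] U (shift m g) + (e ℕ.+ E) ≤ V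
        shifted []      m _     = deg-zero (U-zero (shift-[] m))
        shifted (x ∷ g) m bound = deg-cong (≈ₚ-sym (U-shift-∷ m x g)) (deg-⊕ head (shifted g (suc m) tail))
          where
          tail : Deg[ (λ j → wt (suc m ℕ.+ j)) ] g + e ≤ V
          tail = deg≤ λ j → ≡.subst (λ k → V < wt k ℕ.+ e → coeff g j ≈ 0#) (ℕₚ.+-suc m j) (vanish bound (suc j))
          head : Deg[ wt ] scale x (U (yPow m)) + (e ℕ.+ E) ≤ V
          head with wt m ℕ.+ e ℕₚ.≤? V
          ... | yes wtₘ+e≤V = deg-scale x (deg-offset (lowers m) wtₘ+e≤V)
          ... | no  wtₘ+e≰V = deg-zero (scale-zeroˡ _ x≈0)
            where
            x≈0 : x ≈ 0#
            x≈0 = ≡.subst (λ k → V < wt k ℕ.+ e → x ≈ 0#) (ℕₚ.+-identityʳ m) (vanish bound 0) (ℕₚ.≰⇒> wtₘ+e≰V)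

      iter-lowers-weight : ∀ n {f V} → Deg[ wt ] f + 0 ≤ V → Deg[ wt ] iter U n f + n ℕ.* E ≤ V
      iter-lowers-weight zero    bound = bound
      iter-lowers-weight (suc n) {f} {V} bound = ≡.subst (λ s → Deg[ wt ] iter U (suc n) f + s ≤ V)
        (ℕₚ.+-comm (n ℕ.* E) E) (U-lowers-weight (iter-lowers-weight n bound))

  module Recursion (T : Pol → Pol) (T-linear : IsLinear T) where

    -- Φ A h = Σⱼ Aⱼ · T (yʲ h): A(X) acting on the sequence j ↦ T (yʲ h), X being the shift.
    Φ : X.Pol → Pol → Pol
    Φ []      h = []
    Φ (g ∷ A) h = (g ⊛ T h) ⊕ Φ A (0# ∷ h)

    Φ-zeroˡ : ∀ {A} h → A X.≈ₚ [] → Φ A h ≈ₚ []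
    Φ-zeroˡ {[]}    h A≈0 = ≈ₚ-refl
    Φ-zeroˡ {g ∷ A} h A≈0 =
      ⊕-cong (⊛-zeroˡ (T h) (X.coeff-≈ A≈0 0)) (Φ-zeroˡ {A} (0# ∷ h) (X.coeffwise λ i → X.coeff-≈ A≈0 (suc i)))

    Φ-congˡ : ∀ {A B} h → A X.≈ₚ B → Φ A h ≈ₚ Φ B h
    Φ-congˡ {[]}    {B}      h A≈B = ≈ₚ-sym (Φ-zeroˡ h (X.≈ₚ-sym A≈B))
    Φ-congˡ {g ∷ A} {[]}     h A≈B = Φ-zeroˡ h A≈B
    Φ-congˡ {g ∷ A} {g′ ∷ B} h A≈B = ⊕-cong (⊛-congˡ (T h) (X.coeff-≈ A≈B 0)) (Φ-congˡ (0# ∷ h) (X.∷-tail A≈B))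

    Φ-linear : ∀ A → IsLinear (Φ A)
    Φ-linear A = record
      { cong        = λ f g f≈g → coeff-≈ (Φ-congʳ A (coeffwise f≈g))
      ; additive    = λ f g → coeff-≈ (Φ-⊕ʳ A f g)
      ; homogeneous = λ a f → coeff-≈ (Φ-scaleʳ A a f)
      }
      where
      Φ-congʳ : ∀ A {h h′} → h ≈ₚ h′ → Φ A h ≈ₚ Φ A h′
      Φ-congʳ []      h≈h′ = ≈ₚ-refl
      Φ-congʳ (g ∷ A) h≈h′ = ⊕-cong (⊛-congʳ g (U-cong T-linear h≈h′)) (Φ-congʳ A (∷-cong refl h≈h′))
      Φ-⊕ʳ : ∀ A h h′ → Φ A (h ⊕ h′) ≈ₚ (Φ A h ⊕ Φ A h′)
      Φ-⊕ʳ []      h h′ = ≈ₚ-refl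
      Φ-⊕ʳ (g ∷ A) h h′ = ≈ₚ-trans
        (⊕-cong (≈ₚ-trans (⊛-congʳ g (U-⊕ T-linear h h′)) (⊛-distribˡ g (T h) (T h′)))
                (≈ₚ-trans (Φ-congʳ A (0∷-⊕ h h′)) (Φ-⊕ʳ A (0# ∷ h) (0# ∷ h′))))
        (⊕-interchange (g ⊛ T h) (g ⊛ T h′) (Φ A (0# ∷ h)) (Φ A (0# ∷ h′)))
      Φ-scaleʳ : ∀ A a h → Φ A (scale a h) ≈ₚ scale a (Φ A h)
      Φ-scaleʳ []      a h = ≈ₚ-refl
      Φ-scaleʳ (g ∷ A) a h = ≈ₚ-trans
        (⊕-cong (≈ₚ-trans (⊛-congʳ g (U-scale T-linear a h)) (⊛-scale a g (T h)))
                (≈ₚ-trans (Φ-congʳ A (≈ₚ-sym (scale-0∷ a h))) (Φ-scaleʳ A a (0# ∷ h))))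
        (≈ₚ-sym (scale-⊕ a (g ⊛ T h) (Φ A (0# ∷ h))))

    Φ-⊕ˡ : ∀ A B h → Φ (A X.⊕ B) h ≈ₚ (Φ A h ⊕ Φ B h)
    Φ-⊕ˡ []      B        h = ≈ₚ-refl
    Φ-⊕ˡ (g ∷ A) []       h = ≈ₚ-sym (⊕-identityʳ _)
    Φ-⊕ˡ (g ∷ A) (g′ ∷ B) h = ≈ₚ-trans (⊕-cong (⊛-distribʳ g g′ (T h)) (Φ-⊕ˡ A B (0# ∷ h)))
      (⊕-interchange (g ⊛ T h) (g′ ⊛ T h) (Φ A (0# ∷ h)) (Φ B (0# ∷ h)))

    Φ-scaleˡ : ∀ u A h → Φ (X.scale u A) h ≈ₚ (u ⊛ Φ A h)
    Φ-scaleˡ u []      h = ≈ₚ-sym (⊛-zeroʳ u)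
    Φ-scaleˡ u (g ∷ A) h = ≈ₚ-trans (⊕-cong (⊛-assoc u g (T h)) (Φ-scaleˡ u A (0# ∷ h)))
      (≈ₚ-sym (⊛-distribˡ u (g ⊛ T h) (Φ A (0# ∷ h))))

    Φ-C : ∀ u h → Φ (X.C u) h ≈ₚ (u ⊛ T h)
    Φ-C u h = ⊕-identityʳ _

    Φ-shiftˡ : ∀ n A h → Φ (X.shift n A) h ≈ₚ Φ A (shift n h)
    Φ-shiftˡ zero    A h = ≈ₚ-refl
    Φ-shiftˡ (suc n) A h = ≈ₚ-trans (Φ-shiftˡ n A (0# ∷ h)) (≈ₚ-reflexive (≡.cong (Φ A) (shift-0∷ n h)))

    Φ-var^ : ∀ n h → Φ (X.var X.^ₚ n) h ≈ₚ T (shift n h)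
    Φ-var^ n h = begin
      Φ (X.var X.^ₚ n) h                    ≈⟨ Φ-congˡ h (X.≈ₚ-sym (X.Ringₚ.*-identityʳ (X.var X.^ₚ n))) ⟩
      Φ ((X.var X.^ₚ n) X.⊛ X.C (C 1#)) h   ≈⟨ Φ-congˡ h (X.var^-⊛ n (X.C (C 1#))) ⟩
      Φ (X.shift n (X.C (C 1#))) h          ≈⟨ Φ-shiftˡ n (X.C (C 1#)) h ⟩
      Φ (X.C (C 1#)) (shift n h)            ≈⟨ Φ-C (C 1#) (shift n h) ⟩
      C 1# ⊛ T (shift n h)                  ≈⟨ ⊛-identityˡ (T (shift n h)) ⟩
      T (shift n h)                         ∎
      where open ≈ₚ-Reasoning

    Φ-monomial : ∀ u n h → Φ (X.C u X.⊛ (X.var X.^ₚ n)) h ≈ₚ (u ⊛ T (shift n h))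
    Φ-monomial u n h = ≈ₚ-trans (Φ-congˡ h (X.⊛-singleˡ u (X.var X.^ₚ n)))
      (≈ₚ-trans (Φ-scaleˡ u (X.var X.^ₚ n) h) (⊛-congʳ u (Φ-var^ n h)))

    Φ-∑ : ∀ n (G : Fin n → X.Pol) h → Φ (X.∑ₚ n G) h ≈ₚ ∑ₚ n (λ i → Φ (G i) h)
    Φ-∑ zero    G h = ≈ₚ-refl
    Φ-∑ (suc n) G h = ≈ₚ-trans (Φ-⊕ˡ (G Fin.zero) _ h) (⊕-cong ≈ₚ-refl (Φ-∑ n (λ i → G (Fin.suc i)) h))

    Φ-⊛-annihilator : ∀ {A} → (∀ h → Φ A h ≈ₚ []) → ∀ B h → Φ (B X.⊛ A) h ≈ₚ []
    Φ-⊛-annihilator     ΦA≈0 []      h = ≈ₚ-refl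
    Φ-⊛-annihilator {A} ΦA≈0 (b ∷ B) h = ≈ₚ-trans (Φ-⊕ˡ (X.scale b A) ([] ∷ (B X.⊛ A)) h)
      (⊕-cong (≈ₚ-trans (Φ-scaleˡ b A h) (≈ₚ-trans (⊛-congʳ b (ΦA≈0 h)) (⊛-zeroʳ b)))
              (Φ-⊛-annihilator ΦA≈0 B (0# ∷ h)))

    Φ-++ : ∀ A B h → Φ (A ++ B) h ≈ₚ (Φ A h ⊕ Φ B (shift (length A) h))
    Φ-++ []      B h = ≈ₚ-refl
    Φ-++ (g ∷ A) B h = ≈ₚ-trans
      (⊕-cong (≈ₚ-refl {g ⊛ T h}) (≡.subst (λ k → Φ (A ++ B) (0# ∷ h) ≈ₚ (Φ A (0# ∷ h) ⊕ Φ B k))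
                                     (shift-0∷ (length A) h) (Φ-++ A B (0# ∷ h))))
      (≈ₚ-sym (⊕-assoc (g ⊛ T h) (Φ A (0# ∷ h)) (Φ B (shift (suc (length A)) h))))

    recurrenceSum : ∀ {d} → Vec Pol d → ℕ → Pol
    recurrenceSum {d} as n =
      sumPol (Vec.toList (Vec.tabulate (λ (i : Fin d) → Vec.lookup as i ⊛ T (yPow (n ∸ suc (toℕ i))))))

    -- companion as = lowerCoefficients as ++ [1], coefficients listed from X⁰ upwards
    lowerCoefficients : ∀ {d} → Vec Pol d → X.Pol
    lowerCoefficients as = map neg (reverse (Vec.toList as))

    Φ-lowerCoefficients-∷ʳ : ∀ {d} (as : Vec Pol d) g m →
      Φ (lowerCoefficients as ++ (g ∷ [])) (yPow m) ≈ₚ (Φ (lowerCoefficients as) (yPow m) ⊕ (g ⊛ T (yPow (d ℕ.+ m))))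
    Φ-lowerCoefficients-∷ʳ {d} as g m = ≈ₚ-trans (Φ-++ (lowerCoefficients as) (g ∷ []) (yPow m))
      (⊕-cong ≈ₚ-refl (≈ₚ-trans (≈ₚ-reflexive (≡.cong (Φ (g ∷ [])) shifted)) (Φ-C g (yPow (d ℕ.+ m)))))
      where
      length≡d : length (lowerCoefficients as) ≡ d
      length≡d = ≡.trans (Listₚ.length-map neg (reverse (Vec.toList as)))
                   (≡.trans (Listₚ.length-reverse (Vec.toList as)) (Vecₚ.length-toList as))
      shifted : shift (length (lowerCoefficients as)) (yPow m) ≡ yPow (d ℕ.+ m)
      shifted = ≡.trans (≡.cong (λ k → shift k (yPow m)) length≡d) (shift-yPow d m)

    Φ-lowerCoefficients : ∀ {d} (as : Vec Pol d) m →
      Φ (lowerCoefficients as) (yPow m) ≈ₚ neg (recurrenceSum as (d ℕ.+ m))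
    Φ-lowerCoefficients Vec.[]               m = ≈ₚ-refl
    Φ-lowerCoefficients {suc d} (a Vec.∷ as) m = begin
      Φ (lowerCoefficients (a Vec.∷ as)) (yPow m)    ≈⟨ Φ-congˡ (yPow m) (X.≈ₚ-reflexive unfold) ⟩
      Φ (lowerCoefficients as ++ (neg a ∷ [])) (yPow m) ≈⟨ Φ-lowerCoefficients-∷ʳ as (neg a) m ⟩
      Φ (lowerCoefficients as) (yPow m) ⊕ (neg a ⊛ t) ≈⟨ ⊕-cong (Φ-lowerCoefficients as m) (≈ₚ-sym (-‿distribˡ-* a t)) ⟩
      neg S ⊕ neg (a ⊛ t)                            ≈⟨ ⊕-comm (neg S) (neg (a ⊛ t)) ⟩
      neg (a ⊛ t) ⊕ neg S                            ≈⟨ -‿+-comm (a ⊛ t) S ⟩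
      neg ((a ⊛ t) ⊕ S)                              ∎
      where
      open ≈ₚ-Reasoning
      t = T (yPow (d ℕ.+ m))
      S = recurrenceSum as (d ℕ.+ m)
      unfold : map neg (reverse (a ∷ Vec.toList as)) ≡ lowerCoefficients as ++ (neg a ∷ [])
      unfold = ≡.trans (≡.cong (map neg) (Listₚ.unfold-reverse a (Vec.toList as)))
                       (Listₚ.map-++ neg (reverse (Vec.toList as)) (a ∷ []))

    companion-annihilates : ∀ {d} (as : Vec Pol d) → SatisfiesRecursion (λ n → T (yPow n)) as →
                            ∀ h → Φ (companion as) h ≈ₚ []
    companion-annihilates {d} as recursion = U-monomials (Φ-linear (companion as)) on-monomial
      where
      on-monomial : ∀ m → Φ (companion as) (yPow m) ≈ₚ []
      on-monomial m = begin
        Φ (lowerCoefficients as ++ (C 1# ∷ [])) (yPow m)  ≈⟨ Φ-lowerCoefficients-∷ʳ as (C 1#) m ⟩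
        Φ (lowerCoefficients as) (yPow m) ⊕ (C 1# ⊛ t)    ≈⟨ ⊕-cong (Φ-lowerCoefficients as m) (⊛-identityˡ t) ⟩
        neg S ⊕ t                                        ≈⟨ ⊕-cong (≈ₚ-refl {neg S}) (coeffwise (recursion n (ℕₚ.m≤m+n d m))) ⟩
        neg S ⊕ S                                        ≈⟨ neg-inverseˡ S ⟩
        []                                               ∎
        where
        open ≈ₚ-Reasoning
        n = d ℕ.+ m
        t = T (yPow n)
        S = recurrenceSum as n

  module KeyIdentity {p} (p-prime : Prime p) (char : natToF p ≈ 0#) (k : ℕ) (T : Pol → Pol) (T-linear : IsLinear T)
                     {d} (d≤q : d ≤ p ℕ.^ k) (a : Carrier) (as : Vec Pol d)
                     (recursion : SatisfiesRecursion (λ n → T (yPow n)) as) where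

    open Recursion T T-linear
    open SemiringExp X.Ringₚ.semiring using (^-congˡ; ^-assocʳ; ^-homo-*)

    q : ℕ
    q = p ℕ.^ k

    char-×1 : p × 1# ≈ 0#
    char-×1 = ≡.subst (_≈ 0#) (natToF≡×1 p) char
      where
      natToF≡×1 : ∀ n → natToF n ≡ n × 1#
      natToF≡×1 zero    = ≡.refl
      natToF≡×1 (suc n) = ≡.cong (λ x → 1# + x) (natToF≡×1 n)

    module FrobeniusY = PolynomialFrobenius.Characteristic commRing p-prime char-×1
    module FrobeniusX = PolynomialFrobenius.Characteristic polyRing p-prime FrobeniusY.char-poly

    q^e≡p^ke : ∀ e → q ℕ.^ e ≡ p ℕ.^ (k ℕ.* e)
    q^e≡p^ke e = ℕₚ.^-*-assoc p k e

    frobeniusX : ∀ e A B → ((A X.⊕ B) X.^ₚ (q ℕ.^ e)) X.≈ₚ ((A X.^ₚ (q ℕ.^ e)) X.⊕ (B X.^ₚ (q ℕ.^ e)))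
    frobeniusX e A B = ≡.subst (λ n → ((A X.⊕ B) X.^ₚ n) X.≈ₚ ((A X.^ₚ n) X.⊕ (B X.^ₚ n)))
                         (≡.sym (q^e≡p^ke e)) (FrobeniusX.frobeniusₚ-^ (k ℕ.* e) A B)

    frobeniusX-monomials : ∀ e A → (A X.^ₚ (q ℕ.^ e)) X.≈ₚ
      X.∑ₚ (length A) (λ j → X.C (X.coeff A (toℕ j) ^ₚ (q ℕ.^ e)) X.⊛ (X.var X.^ₚ (toℕ j ℕ.* q ℕ.^ e)))
    frobeniusX-monomials e A = ≡.subst
      (λ n → (A X.^ₚ n) X.≈ₚ X.∑ₚ (length A) (λ j → X.C (X.coeff A (toℕ j) ^ₚ n) X.⊛ (X.var X.^ₚ (toℕ j ℕ.* n))))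
      (≡.sym (q^e≡p^ke e)) (FrobeniusX.frobenius-monomials (k ℕ.* e) A)

    frobeniusY-monomials : ∀ e f → (f ^ₚ (q ℕ.^ e)) ≈ₚ
      ∑ₚ (length f) (λ i → C (coeff f (toℕ i) ^ (q ℕ.^ e)) ⊛ (var ^ₚ (toℕ i ℕ.* q ℕ.^ e)))
    frobeniusY-monomials e f = ≡.subst
      (λ n → (f ^ₚ n) ≈ₚ ∑ₚ (length f) (λ i → C (coeff f (toℕ i) ^ n) ⊛ (var ^ₚ (toℕ i ℕ.* n))))
      (≡.sym (q^e≡p^ke e)) (FrobeniusY.frobenius-monomials (k ℕ.* e) f)

    cy : Pol
    cy = 0# ∷ a ∷ []

    Z : X.Pol
    Z = XplusCy a

    Q : X.Pol
    Q = (Z X.^ₚ (q ∸ d)) X.⊛ companion as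

    -- Q = Z^q + Rq, and Rq inherits the low total degree of the companion polynomial minus Z^d.
    Rq : X.Pol
    Rq = (Z X.^ₚ (q ∸ d)) X.⊛ (companion as X.⊕ X.neg (powX Z d))

    κ : ℕ → Pol
    κ = X.coeff Rq

    Q-split : Q X.≈ₚ (((X.var X.^ₚ q) X.⊕ (X.C cy X.^ₚ q)) X.⊕ Rq)
    Q-split = begin
      Z^[q-d] X.⊛ P                                   ≈⟨ X.⊛-congʳ Z^[q-d] P≈Z^d+Rest ⟩
      Z^[q-d] X.⊛ ((Z X.^ₚ d) X.⊕ Rest)               ≈⟨ X.⊛-distribˡ Z^[q-d] (Z X.^ₚ d) Rest ⟩
      (Z^[q-d] X.⊛ (Z X.^ₚ d)) X.⊕ Rq                 ≈⟨ X.⊕-cong (X.≈ₚ-sym (^-homo-* Z (q ∸ d) d)) (X.≈ₚ-refl {Rq}) ⟩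
      (Z X.^ₚ ((q ∸ d) ℕ.+ d)) X.⊕ Rq              ≡⟨ ≡.cong (λ n → (Z X.^ₚ n) X.⊕ Rq) (ℕₚ.m∸n+n≡m d≤q) ⟩
      (Z X.^ₚ q) X.⊕ Rq                            ≈⟨ X.⊕-cong (FrobeniusX.frobeniusₚ-^ k X.var (X.C cy)) (X.≈ₚ-refl {Rq}) ⟩
      ((X.var X.^ₚ q) X.⊕ (X.C cy X.^ₚ q)) X.⊕ Rq  ∎
      where
      open X.≈ₚ-Reasoning
      P = companion as
      Z^[q-d] = Z X.^ₚ (q ∸ d)
      Z^d = Z X.^ₚ d
      Rest = P X.⊕ X.neg (powX Z d)
      powX≡^ : ∀ n → powX Z n ≡ Z X.^ₚ n
      powX≡^ zero    = ≡.refl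
      powX≡^ (suc n) = ≡.cong (Z X.⊛_) (powX≡^ n)
      P≈Z^d+Rest : P X.≈ₚ (Z^d X.⊕ Rest)
      P≈Z^d+Rest = begin
        P                                ≈⟨ X.⊕-identityʳ P ⟨
        P X.⊕ []                         ≈⟨ X.⊕-cong (X.≈ₚ-refl {P}) (X.neg-inverseˡ Z^d) ⟨
        P X.⊕ (X.neg Z^d X.⊕ Z^d)          ≈⟨ X.⊕-assoc P (X.neg Z^d) Z^d ⟨
        (P X.⊕ X.neg Z^d) X.⊕ Z^d          ≈⟨ X.⊕-comm (P X.⊕ X.neg Z^d) Z^d ⟩
        Z^d X.⊕ (P X.⊕ X.neg Z^d)          ≡⟨ ≡.cong (λ B → Z^d X.⊕ (P X.⊕ X.neg B)) (≡.sym (powX≡^ d)) ⟩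
        Z^d X.⊕ Rest                      ∎

    Φ-Q^≈0 : ∀ e h → Φ (Q X.^ₚ (q ℕ.^ e)) h ≈ₚ []
    Φ-Q^≈0 e h with q ℕ.^ e | ℕₚ.m^n>0 q {{ℕₚ.m^n≢0 p k {{prime⇒nonZero p-prime}}}} e
    ... | suc m | _ = ≈ₚ-trans (Φ-congˡ h Q^1+m≈)
                        (Φ-⊛-annihilator (companion-annihilates as recursion) (Z^[q-d] X.⊛ Q^m) h)
      where
      open X.≈ₚ-Reasoning
      Z^[q-d] = Z X.^ₚ (q ∸ d)
      Q^m = Q X.^ₚ m
      Q^1+m≈ : (Q X.^ₚ suc m) X.≈ₚ ((Z^[q-d] X.⊛ Q^m) X.⊛ companion as)
      Q^1+m≈ = begin
        (Z^[q-d] X.⊛ companion as) X.⊛ Q^m   ≈⟨ X.⊛-assoc Z^[q-d] (companion as) Q^m ⟩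
        Z^[q-d] X.⊛ (companion as X.⊛ Q^m)   ≈⟨ X.⊛-congʳ Z^[q-d] (X.⊛-comm (companion as) Q^m) ⟩
        Z^[q-d] X.⊛ (Q^m X.⊛ companion as)   ≈⟨ X.⊛-assoc Z^[q-d] Q^m (companion as) ⟨
        (Z^[q-d] X.⊛ Q^m) X.⊛ companion as   ∎

    -- the image under Φ _ h of the monomial κⱼᵢ yⁱ Xʲ of Rq raised to the power qᵉ
    tailTerm : ℕ → Pol → ℕ → ℕ → Pol
    tailTerm e h j i = scale (coeff (κ j) i ^ (q ℕ.^ e)) (shift (i ℕ.* q ℕ.^ e) (T (shift (j ℕ.* q ℕ.^ e) h)))

    tailSum : ℕ → Pol → Pol
    tailSum e h = ∑ₚ (length Rq) (λ j → ∑ₚ (length (κ (toℕ j))) (λ i → tailTerm e h (toℕ j) (toℕ i)))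

    Φ-Rq^ : ∀ e h → Φ (Rq X.^ₚ (q ℕ.^ e)) h ≈ₚ tailSum e h
    Φ-Rq^ e h = begin
      Φ (Rq X.^ₚ qᵉ) h                                       ≈⟨ Φ-congˡ h (frobeniusX-monomials e Rq) ⟩
      Φ (X.∑ₚ (length Rq) (λ j → monomialⱼ (toℕ j))) h       ≈⟨ Φ-∑ (length Rq) (λ j → monomialⱼ (toℕ j)) h ⟩
      ∑ₚ (length Rq) (λ j → Φ (monomialⱼ (toℕ j)) h)         ≈⟨ ∑ₚ-cong {length Rq} (λ j → Φ-monomialⱼ (toℕ j)) ⟩
      tailSum e h                                           ∎
      where
      open ≈ₚ-Reasoning
      qᵉ = q ℕ.^ e
      monomialⱼ : ℕ → X.Pol
      monomialⱼ j = X.C (κ j ^ₚ qᵉ) X.⊛ (X.var X.^ₚ (j ℕ.* qᵉ))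
      Φ-monomialⱼ : ∀ j → Φ (monomialⱼ j) h ≈ₚ ∑ₚ (length (κ j)) (λ i → tailTerm e h j (toℕ i))
      Φ-monomialⱼ j = begin
        Φ (monomialⱼ j) h                                              ≈⟨ Φ-monomial (κ j ^ₚ qᵉ) (j ℕ.* qᵉ) h ⟩
        (κ j ^ₚ qᵉ) ⊛ t                                                ≈⟨ ⊛-congˡ t (frobeniusY-monomials e (κ j)) ⟩
        ∑ₚ (length (κ j)) (λ i → C (cᵢ i) ⊛ (var ^ₚ (toℕ i ℕ.* qᵉ))) ⊛ t
          ≈⟨ ⊛-distribʳ-∑ₚ {length (κ j)} t (λ i → C (cᵢ i) ⊛ (var ^ₚ (toℕ i ℕ.* qᵉ))) ⟩
        ∑ₚ (length (κ j)) (λ i → (C (cᵢ i) ⊛ (var ^ₚ (toℕ i ℕ.* qᵉ))) ⊛ t)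
          ≈⟨ ∑ₚ-cong {length (κ j)} (λ i → monomial-⊛ (cᵢ i) (toℕ i ℕ.* qᵉ) t) ⟩
        ∑ₚ (length (κ j)) (λ i → tailTerm e h j (toℕ i))                ∎
        where
        t = T (shift (j ℕ.* qᵉ) h)
        cᵢ : Fin (length (κ j)) → Carrier
        cᵢ i = coeff (κ j) (toℕ i) ^ qᵉ

    Φ-cy^ : ∀ e h → Φ ((X.C cy X.^ₚ q) X.^ₚ (q ℕ.^ e)) h ≈ₚ scale (a ^ (q ℕ.^ suc e)) (shift (q ℕ.^ suc e) (T h))
    Φ-cy^ e h = begin
      Φ ((X.C cy X.^ₚ q) X.^ₚ (q ℕ.^ e)) h    ≈⟨ Φ-congˡ h (X.≈ₚ-trans (^-assocʳ (X.C cy) q (q ℕ.^ e)) (X.C-^ cy N)) ⟩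
      Φ (X.C (cy ^ₚ N)) h                      ≈⟨ Φ-C (cy ^ₚ N) h ⟩
      (cy ^ₚ N) ⊛ T h                          ≈⟨ ⊛-congˡ (T h) cyᴺ≈ ⟩
      (C (a ^ N) ⊛ (var ^ₚ N)) ⊛ T h           ≈⟨ monomial-⊛ (a ^ N) N (T h) ⟩
      scale (a ^ N) (shift N (T h))            ∎
      where
      open ≈ₚ-Reasoning
      N = q ℕ.^ suc e
      cy≈ : cy ≈ₚ (C a ⊛ var)
      cy≈ = ≈ₚ-sym (≈ₚ-trans (⊛-singleˡ a var) (∷-cong (zeroʳ a) (∷-cong (*-identityʳ a) ≈ₚ-refl)))
      cyᴺ≈ : (cy ^ₚ N) ≈ₚ (C (a ^ N) ⊛ (var ^ₚ N))
      cyᴺ≈ = ≈ₚ-trans (SemiringExp.^-congˡ Ringₚ.semiring N cy≈)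
        (≈ₚ-trans (CommutativeSemiringExp.^-distrib-* Ringₚ.commutativeSemiring (C a) var N)
                  (⊛-congˡ (var ^ₚ N) (C-^ a N)))

    -- Frobenius splits Φ (Q ^ qᵉ) h = 0 into its X^N, (cy)^N and Rq^(qᵉ) parts, N = q^(e+1).
    key-identity : ∀ e h →
      T (shift (q ℕ.^ suc e) h) ≈ₚ neg (scale (a ^ (q ℕ.^ suc e)) (shift (q ℕ.^ suc e) (T h)) ⊕ tailSum e h)
    key-identity e h = +-inverseˡ-unique (T (shift N h)) (A ⊕ B) (begin
      T (shift N h) ⊕ (A ⊕ B)                    ≈⟨ ⊕-assoc (T (shift N h)) A B ⟨
      (T (shift N h) ⊕ A) ⊕ B                    ≈⟨ ⊕-cong (⊕-cong Φ-V (Φ-cy^ e h)) (Φ-Rq^ e h) ⟨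
      (Φ V h ⊕ Φ W h) ⊕ Φ (Rq X.^ₚ qᵉ) h          ≈⟨ ⊕-cong (Φ-⊕ˡ V W h) ≈ₚ-refl ⟨
      Φ (V X.⊕ W) h ⊕ Φ (Rq X.^ₚ qᵉ) h            ≈⟨ Φ-⊕ˡ (V X.⊕ W) (Rq X.^ₚ qᵉ) h ⟨
      Φ ((V X.⊕ W) X.⊕ (Rq X.^ₚ qᵉ)) h            ≈⟨ Φ-congˡ h Q^qᵉ-split ⟨
      Φ (Q X.^ₚ qᵉ) h                            ≈⟨ Φ-Q^≈0 e h ⟩
      []                                         ∎)
      where
      open ≈ₚ-Reasoning
      qᵉ = q ℕ.^ e
      N = q ℕ.^ suc e
      A = scale (a ^ N) (shift N (T h))
      B = tailSum e h
      V = (X.var X.^ₚ q) X.^ₚ qᵉ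
      W = (X.C cy X.^ₚ q) X.^ₚ qᵉ
      Φ-V : Φ V h ≈ₚ T (shift N h)
      Φ-V = ≈ₚ-trans (Φ-congˡ h (^-assocʳ X.var q qᵉ)) (Φ-var^ N h)
      Q^qᵉ-split : (Q X.^ₚ qᵉ) X.≈ₚ ((V X.⊕ W) X.⊕ (Rq X.^ₚ qᵉ))
      Q^qᵉ-split = X.≈ₚ-trans (^-congˡ qᵉ Q-split)
        (X.≈ₚ-trans (frobeniusX e _ Rq) (X.⊕-cong (frobeniusX e (X.var X.^ₚ q) (X.C cy X.^ₚ q)) X.≈ₚ-refl))

    Rq-vanishes : ∀ {D} → Polys.TotDegAtMost F (companion as X.⊕ X.neg (powX Z d)) (+ d -ℤ + D) →
                  ∀ j i → q < i ℕ.+ (j ℕ.+ D) → coeff (κ j) i ≈ 0#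
    Rq-vanishes {D} hyp j i = ≡.subst (λ m → m < i ℕ.+ (j ℕ.+ D) → coeff (κ j) i ≈ 0#) (ℕₚ.m∸n+n≡m d≤q)
                                (vanish (coefficient totDeg-Rq j) i)
      where
      open Bivariate commRing using (TotDeg_+_≤_; totDeg≤; coefficient; totDeg-⊛; totDeg-^)
      totDeg-Rest : TotDeg companion as X.⊕ X.neg (powX Z d) + D ≤ d
      totDeg-Rest = totDeg≤ λ j → deg≤ λ i lt → hyp j i (m<n+o⇒m-o<n (≡.subst (d <_) (≡.sym (ℕₚ.+-assoc i j D)) lt))
      totDeg-Rq : TotDeg Rq + D ≤ (q ∸ d) ℕ.+ d
      totDeg-Rq = totDeg-⊛ (Z X.^ₚ (q ∸ d)) (totDeg-^ a (q ∸ d)) totDeg-Rest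

  module WeightLowering {p} (p-prime : Prime p) (char : natToF p ≈ 0#) (k : ℕ) (T : Pol → Pol) (T-linear : IsLinear T)
      (E : ℕ) (lowers-degree : ∀ f m → DegAtMost f m → DegAtMost (T f) (m -ℤ + E))
      {D d} (d≤q : d ≤ p ℕ.^ k) (1≤D : 1 ≤ D) (2+D≤q : 2 ℕ.+ D ≤ p ℕ.^ k) (a : Carrier) (as : Vec Pol d)
      (hyp : Polys.TotDegAtMost F (Polys.PX._⊕_ F (companion as) (Polys.PX.neg F (powX (XplusCy a) d))) (+ d -ℤ + D))
      (recursion : SatisfiesRecursion (λ n → T (yPow n)) as) where

    open KeyIdentity p-prime char k T T-linear d≤q a as recursion

    r : ℕ
    r = q ∸ D

    1<q : 1 < q
    1<q = ℕₚ.≤-trans (ℕₚ.m≤m+n 2 D) 2+D≤q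

    D≤q : D ≤ q
    D≤q = ℕₚ.≤-trans (ℕₚ.m≤n+m D 2) 2+D≤q

    2≤r : 2 ≤ r
    2≤r = ℕₚ.+-cancelʳ-≤ D 2 r (≡.subst (2 ℕ.+ D ≤_) (≡.sym (ℕₚ.m∸n+n≡m D≤q)) 2+D≤q)

    r<q : r < q
    r<q = ℕₚ.∸-monoʳ-< {q} {D} {0} 1≤D D≤q

    open DigitWeight q r 1<q (ℕₚ.m∸n≤m q D)

    LowersBelow : ℕ → Set ℓ
    LowersBelow n = ∀ m → m < n → Deg[ w ] T (yPow m) + E ≤ w m

    T-lowers-weight-<q : ∀ n → n < q → Deg[ w ] T (yPow n) + E ≤ w n
    T-lowers-weight-<q n n<q = deg≤ λ m lt →
      lowers-degree (yPow n) (+ n) (yPow-degree n) m (m<n+o⇒m-o<n (ℕₚ.<-≤-trans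
        (≡.subst (_< w m ℕ.+ E) (w-small n n<q) lt) (ℕₚ.+-monoˡ-≤ E (w-≤ m))))

    module _ (e n′ : ℕ) (lowers : LowersBelow (q ℕ.^ suc e ℕ.+ n′)) where

      leading-bound : Deg[ w ] scale (a ^ (q ℕ.^ suc e)) (shift (q ℕ.^ suc e) (T (yPow n′))) + E ≤ r ℕ.^ suc e ℕ.+ w n′
      leading-bound = deg-weaken (ℕₚ.≤-reflexive w-sum)
        (deg-scale _ (deg-shift w-subadditive (q ℕ.^ suc e) (lowers n′ (ℕₚ.m<n+m n′ (ℕₚ.m^n>0 q (suc e))))))
        where
        w-sum : w n′ ℕ.+ w (q ℕ.^ suc e) ≡ r ℕ.^ suc e ℕ.+ w n′
        w-sum = ≡.trans (≡.cong (w n′ ℕ.+_) (w-q^ (suc e))) (ℕₚ.+-comm (w n′) (r ℕ.^ suc e))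

      tailTerm-bound : ∀ j i → Deg[ w ] tailTerm e (yPow n′) j i + E ≤ r ℕ.^ suc e ℕ.+ w n′
      tailTerm-bound j i with i ℕ.+ j ℕₚ.≤? r
      ... | yes i+j≤r = deg-weaken (w-tail-bound e i j n′ i+j≤r)
                          (deg-scale _ (deg-shift w-subadditive (i ℕ.* q ℕ.^ e) lowers-shifted))
        where
        m = j ℕ.* q ℕ.^ e ℕ.+ n′
        m<N+n′ : m < q ℕ.^ suc e ℕ.+ n′
        m<N+n′ = ℕₚ.+-monoˡ-< n′ (ℕₚ.*-monoˡ-< (q ℕ.^ e) {{ℕₚ.m^n≢0 q e}}
                   (ℕₚ.≤-<-trans (ℕₚ.≤-trans (ℕₚ.m≤n+m j i) i+j≤r) r<q))
        lowers-shifted : Deg[ w ] T (shift (j ℕ.* q ℕ.^ e) (yPow n′)) + E ≤ w m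
        lowers-shifted = ≡.subst (λ h → Deg[ w ] T h + E ≤ w m) (≡.sym (shift-yPow (j ℕ.* q ℕ.^ e) n′))
                           (lowers m m<N+n′)
      ... | no  i+j≰r = deg-zero (scale-zeroˡ _ (trans (SemiringExp.^-congˡ semiring (q ℕ.^ e) κⱼᵢ≈0)
                                                        (Frobenius.0#^ commRing (q ℕ.^ e) {{ℕₚ.m^n≢0 q e}})))
        where
        q<i+[j+D] : q < i ℕ.+ (j ℕ.+ D)
        q<i+[j+D] = ≡.subst₂ _<_ (ℕₚ.m∸n+n≡m D≤q) (ℕₚ.+-assoc i j D) (ℕₚ.+-monoˡ-< D (ℕₚ.≰⇒> i+j≰r))
        κⱼᵢ≈0 : coeff (κ j) i ≈ 0#
        κⱼᵢ≈0 = Rq-vanishes hyp j i q<i+[j+D]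

      T-lowers-weight-≥q : n′ ℕ.+ q ℕ.^ suc e < q ℕ.^ suc (suc e) →
                           Deg[ w ] T (yPow (q ℕ.^ suc e ℕ.+ n′)) + E ≤ w (q ℕ.^ suc e ℕ.+ n′)
      T-lowers-weight-≥q n′+N<qN = deg-weaken weight-jump
        (≡.subst (λ h → Deg[ w ] T h + E ≤ r ℕ.^ suc e ℕ.+ w n′) (shift-yPow N n′)
          (deg-cong (≈ₚ-sym (key-identity e (yPow n′)))
            (deg-neg (deg-⊕ leading-bound
              (deg-∑ (length Rq) _ λ j → deg-∑ (length (κ (toℕ j))) _ λ i → tailTerm-bound (toℕ j) (toℕ i))))))
        where
        N = q ℕ.^ suc e
        weight-jump : r ℕ.^ suc e ℕ.+ w n′ ≤ w (N ℕ.+ n′)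
        weight-jump = begin
          r ℕ.^ suc e ℕ.+ w n′   ≡⟨ ℕₚ.+-comm (r ℕ.^ suc e) (w n′) ⟩
          w n′ ℕ.+ r ℕ.^ suc e   ≤⟨ w-+q^ (suc e) n′ n′+N<qN ⟩
          w (n′ ℕ.+ N)           ≡⟨ ≡.cong w (ℕₚ.+-comm n′ N) ⟩
          w (N ℕ.+ n′)           ∎
          where open ℕₚ.≤-Reasoning

    T-lowers-weight : ∀ n → Deg[ w ] T (yPow n) + E ≤ w n
    T-lowers-weight = <-rec _ by-size
      where
      by-size : ∀ n → (∀ {m} → m < n → Deg[ w ] T (yPow m) + E ≤ w m) → Deg[ w ] T (yPow n) + E ≤ w n
      by-size n lowers with n ℕₚ.<? q
      ... | yes n<q = T-lowers-weight-<q n n<q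
      ... | no  n≮q with log-bracket n {{ℕ.>-nonZero (ℕₚ.<-≤-trans (ℕₚ.<-trans ℕ.z<s 1<q) (ℕₚ.≮⇒≥ n≮q))}}
      ...   | zero  , _   , n<q^1   = ⊥-elim (n≮q (≡.subst (n <_) (ℕₚ.*-identityʳ q) n<q^1))
      ...   | suc e , N≤n , n<q^2+e = ≡.subst (λ m → Deg[ w ] T (yPow m) + E ≤ w m) N+n′≡n
          (T-lowers-weight-≥q e n′ (λ m m<N+n′ → lowers (≡.subst (m <_) N+n′≡n m<N+n′)) n′+N<q^2+e)
        where
        N = q ℕ.^ suc e
        n′ = n ∸ N
        N+n′≡n : N ℕ.+ n′ ≡ n
        N+n′≡n = ℕₚ.m+[n∸m]≡n N≤n
        n′+N<q^2+e : n′ ℕ.+ N < q ℕ.^ suc (suc e)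
        n′+N<q^2+e = ≡.subst (_< q ℕ.^ suc (suc e)) (≡.trans (≡.sym N+n′≡n) (ℕₚ.+-comm N n′)) n<q^2+e


open import Level using (Level)
open import Data.Nat using (ℕ; _^_) renaming (_≤_ to _≤ℕ_; _+_ to _+ℕ_)
open import Data.Integer using (+_) renaming (_-_ to _-ℤ_)
open import Data.Product using (Σ; _×_; _,_)

theorem10p1 : ∀ {c ℓ : Level} (F : Field c ℓ) → let open Polys F in
    (p k : ℕ) → Prime p → natToF p ≈ 0# →
    (T : Poly → Poly) → IsLinear T →
    (E : ℕ) → 1 ≤ℕ E →
    (∀ (f : Poly) m → DegAtMost f m → DegAtMost (T f) (m -ℤ + E)) →
    (D d : ℕ) → d ≤ℕ p ^ k → 1 ≤ℕ D → 2 +ℕ D ≤ℕ p ^ k →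
    (a : Carrier) → (as : Vec Poly d) →
    TotDegAtMost (companion as PX.⊕ PX.neg (powX (XplusCy a) d)) (+ d -ℤ + D) →
    SatisfiesRecursion (λ n → T (yPow n)) as →
    ∀ (f : Poly) (n N : ℕ) → IsDeg f n → IsN T f N →
      PowerBound (p ^ k) D E N n
theorem10p1 F p k p-prime char T T-linear E 1≤E lowers-degree D d d≤q 1≤D 2+D≤q a as hyp recursion
            f n N (_ , deg-f) (iterᴺf≉0 , _) =
  powerBound n 1≤E λ V w≤V →
    Y.deg-nonzero (λ iterᴺf≈0 → iterᴺf≉0 (Y.coeff-≈ iterᴺf≈0))
      (iter-lowers-weight T-linear T-lowers-weight N (weight-of-degree deg-f w≤V))
  where
  open OverField F
  open WeightLowering p-prime char k T T-linear E lowers-degree d≤q 1≤D 2+D≤q a as hyp recursion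
  open PowerBoundArithmetic (p ^ k) D 1<q 2≤r
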